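{- Let $T$ and $U$ be points of $\mathrm{PG}(1,E)$, with $T$ scattered. The following are equivalent: (i) there exists a collineation $\kappa\in\mathrm{P\Gamma L}_2(q^t)$ of $\mathrm{PG}(1,q^t)$ whose accompanying automorphism lies in $\mathrm{Gal}(\mathbb{F}_{q^t}/\mathbb{F}_q)$ such that $\mathcal{B}(T)^\kappa=\mathcal{B}(U)$; (ii) $L_T$ and $L_U$ are projectively equivalent in $\mathrm{PG}(1,E)$, i.e. there is a projectivity $\pi$ of $\mathrm{PG}(1,E)$ with $(L_T)^\pi=L_U$.
   Context: Let $q$ be a prime power, $t\ge 2$, and $E=\mathrm{End}_{\mathbb{F}_q}(\mathbb{F}_{q^t})$, the ring of $\mathbb{F}_q$-linear maps $\mathbb{F}_{q^t}\to\mathbb{F}_{q^t}$, maps written on the right ($x\mapsto x^\alpha$) and composed left to right; $E^*$ is its unit group. For $a\in\mathbb{F}_{q^t}$ let $\rho_a\in E$ be $x\mapsto ax$. $E^2$ is a left $E$-module of row vectors with $\mathrm{GL}_2(E)$ acting from the right. A pair $(\alpha,\beta)\in E^2$ is admissible if it is the first row of a matrix in $\mathrm{GL}_2(E)$. The projective line $\mathrm{PG}(1,E)$ is the set of cyclic submodules $E(\alpha,\beta)$ with $(\alpha,\beta)$ admissible (points); $E(\alpha,\beta)=E(\alpha',\beta')$ iff $(\alpha',\beta')=(\gamma\alpha,\gamma\beta)$ for some $\gamma\in E^*$. Two points $E(\alpha,\beta),E(\gamma,\delta)$ are distant if the matrix with rows $(\alpha,\beta)$, $(\gamma,\delta)$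 lies in $\mathrm{GL}_2(E)$, non-distant otherwise. A projectivity of $\mathrm{PG}(1,E)$ is a map $E(\alpha,\beta)\mapsto E((\alpha,\beta)M)$ for a fixed $M\in\mathrm{GL}_2(E)$. $\mathrm{PG}(1,F)$ denotes $\{E(\rho_a,\rho_b): (a,b)\in\mathbb{F}_{q^t}^2\setminus\{(0,0)\}\}$, and $\iota:\mathrm{PG}(1,q^t)\to\mathrm{PG}(1,E)$, $\langle(a,b)\rangle_{q^t}\mapsto E(\rho_a,\rho_b)$. For a point $T$, $L_T$ is the set of points of $\mathrm{PG}(1,F)$ non-distant to $T$, and $\mathcal{B}(T)=\iota^{ -1}(L_T)\subseteq\mathrm{PG}(1,q^t)$; equivalently, for $T=E(\alpha,\beta)$, $\mathcal{B}(T)=\{\langle(u^\alpha,u^\beta)\rangle_{q^t}: u\in\mathbb{F}_{q^t}^*\}$ (an $\mathbb{F}_q$-linear set of rank $t$). $T$ is scattered if $|L_T|=(q^t-1)/(q-1)$. A collineation in $\mathrm{P\Gamma L}_2(q^t)$ has the form $\langle(a,b)\rangle_{q^t}\mapsto\langle(a^\eta,b^\eta)M\rangle_{q^t}$ with $M\in\mathrm{GL}_2(q^t)$ and $\eta$ its accompanying field automorphism. -}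

module Defs where

open import Level using (0ℓ)
open import Data.Nat as ℕ using (ℕ; NonZero; _∸_; _^_)
open import Data.Nat.DivMod using (_/_)
open import Data.Nat.Primality using (Prime)
open import Data.Product using (Σ; ∃; _×_; _,_; proj₁; proj₂)
open import Data.List using (List; length)
open import Data.List.Relation.Unary.All using (All)
open import Data.List.Relation.Unary.Any using (Any)
open import Data.List.Relation.Unary.AllPairs using (AllPairs)
open import Data.List.Relation.Unary.Unique.Propositional using (Unique)
open import Data.List.Membership.Propositional using (_∈_)
open import Relation.Nullary using (¬_)
open import Relation.Binary.PropositionalEquality using (_≡_; _≢_)
open import Algebra.Core using (Op₁; Op₂)
open import Algebra.Structures using (IsCommutativeRing)

IsPrimePower : ℕ → Set
IsPrimePower q = Σ ℕ λ p → Σ ℕ λ k → Prime p × (0 ℕ.< k) × (q ≡ p ^ k)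

record Field : Set₁ where
  infixl 7 _*_
  infixl 6 _+_
  field
    Carrier    : Set
    _+_ _*_    : Op₂ Carrier
    -_         : Op₁ Carrier
    0# 1#      : Carrier
    isCommutativeRing : IsCommutativeRing _≡_ _+_ _*_ -_ 0# 1#
    0≢1        : 0# ≢ 1#
    inverse    : ∀ x → x ≢ 0# → Σ Carrier λ y → x * y ≡ 1#

HasSize : {A : Set} → (A → Set) → ℕ → Set
HasSize {A} P n = Σ (List A) λ xs →
  Unique xs × All P xs × (∀ x → P x → x ∈ xs) × (length xs ≡ n)

module _ (F : Field) where
  open Field F renaming (Carrier to L)

  record IsSubfield (K : L → Set) : Set where
    field
      has0 : K 0#
      has1 : K 1#
      +-closed : ∀ {x y} → K x → K y → K (x + y)
      *-closed : ∀ {x y} → K x → K y → K (x * y)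
      neg-closed : ∀ {x} → K x → K (- x)
      inv-closed : ∀ {x y} → K x → x * y ≡ 1# → K y

  -- The field F_{q^t} = L with subfield F_q = K.
  module Geometry (K : L → Set) where

    -- Elements of E = End_K(L): functions L → L together with K-linearity.
    -- Maps are written on the right, composed left to right.
    Fn : Set
    Fn = L → L

    IsLin : Fn → Set
    IsLin f = (∀ x y → f (x + y) ≡ f x + f y) × (∀ k x → K k → f (k * x) ≡ k * f x)

    _≈_ : Fn → Fn → Set
    f ≈ g = ∀ x → f x ≡ g x

    _⊕_ : Fn → Fn → Fn
    (f ⊕ g) x = f x + g x

    _⊙_ : Fn → Fn → Fn
    (f ⊙ g) x = g (f x)

    idE : Fn
    idE x = x

    zeroE : Fn
    zeroE _ = 0#

    ρ : L → Fn
    ρ a x = a * x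

    IsUnit : Fn → Set
    IsUnit γ = IsLin γ × Σ Fn λ δ → IsLin δ × ((γ ⊙ δ) ≈ idE) × ((δ ⊙ γ) ≈ idE)

    record M2 (A : Set) : Set where
      constructor mat
      field
        m11 m12 m21 m22 : A

    open M2

    _⊗_ : M2 Fn → M2 Fn → M2 Fn
    M ⊗ N = mat ((m11 M ⊙ m11 N) ⊕ (m12 M ⊙ m21 N)) ((m11 M ⊙ m12 N) ⊕ (m12 M ⊙ m22 N))
                ((m21 M ⊙ m11 N) ⊕ (m22 M ⊙ m21 N)) ((m21 M ⊙ m12 N) ⊕ (m22 M ⊙ m22 N))

    I2 : M2 Fn
    I2 = mat idE zeroE zeroE idE

    _≈M_ : M2 Fn → M2 Fn → Set
    M ≈M N = (m11 M ≈ m11 N) × (m12 M ≈ m12 N) × (m21 M ≈ m21 N) × (m22 M ≈ m22 N)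

    LinMat : M2 Fn → Set
    LinMat M = IsLin (m11 M) × IsLin (m12 M) × IsLin (m21 M) × IsLin (m22 M)

    GL2E : M2 Fn → Set
    GL2E M = LinMat M × Σ (M2 Fn) λ N → LinMat N × ((M ⊗ N) ≈M I2) × ((N ⊗ M) ≈M I2)

    Pair : Set
    Pair = Fn × Fn

    _·M_ : Pair → M2 Fn → Pair
    (α , β) ·M M = ((α ⊙ m11 M) ⊕ (β ⊙ m21 M)) , ((α ⊙ m12 M) ⊕ (β ⊙ m22 M))

    Admissible : Pair → Set
    Admissible (α , β) = Σ Fn λ γ → Σ Fn λ δ → GL2E (mat α β γ δ)

    -- E(α,β) = E(α',β')  iff  (α',β') = (γα, γβ) for a unit γ
    SamePoint : Pair → Pair → Set
    SamePoint (α , β) (α' , β') = Σ Fn λ γ → IsUnit γ × ((γ ⊙ α) ≈ α') × ((γ ⊙ β) ≈ β')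

    Distant : Pair → Pair → Set
    Distant (α , β) (γ , δ) = GL2E (mat α β γ δ)

    -- P is (a representative of) a point of PG(1,F)
    InPGF : Pair → Set
    InPGF P = Σ L λ a → Σ L λ b → ¬ (a ≡ 0# × b ≡ 0#) × SamePoint (ρ a , ρ b) P

    LSet : Pair → Pair → Set
    LSet T P = Admissible P × InPGF P × ¬ Distant P T

    NumPoints : (Pair → Set) → ℕ → Set
    NumPoints S n = Σ (List Pair) λ xs →
      All S xs × AllPairs (λ P Q → ¬ SamePoint P Q) xs ×
      (∀ P → S P → Any (SamePoint P) xs) × (length xs ≡ n)

    Scattered : (q t : ℕ) → .{{NonZero (q ∸ 1)}} → Pair → Set
    Scattered q t T = NumPoints (LSet T) ((q ^ t ∸ 1) / (q ∸ 1))

    -- S^f = S' as sets of classes w.r.t. the equivalence ~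
    ImageEq : {A : Set} → (A → A → Set) → (A → Set) → (A → Set) → (A → A) → Set
    ImageEq {A} _~_ S S' f =
      (∀ x → S x → Σ A λ y → S' y × (y ~ f x)) ×
      (∀ y → S' y → Σ A λ x → S x × (f x ~ y))

    LPair : Set
    LPair = L × L

    NonZeroPair : LPair → Set
    NonZeroPair (a , b) = ¬ (a ≡ 0# × b ≡ 0#)

    Proportional : LPair → LPair → Set
    Proportional (a , b) (c , d) = Σ L λ λ' → λ' ≢ 0# × (c ≡ λ' * a) × (d ≡ λ' * b)

    -- 𝓑(T) = ι⁻¹(L_T)
    BSet : Pair → LPair → Set
    BSet T (a , b) = NonZeroPair (a , b) × ¬ Distant (ρ a , ρ b) T

    IsGal : (L → L) → Set
    IsGal η = (∀ x y → η (x + y) ≡ η x + η y) × (∀ x y → η (x * y) ≡ η x * η y) ×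
              (η 1# ≡ 1#) × (Σ (L → L) λ η' → (∀ x → η (η' x) ≡ x) × (∀ x → η' (η x) ≡ x)) ×
              (∀ k → K k → η k ≡ k)

    det : M2 L → L
    det (mat a b c d) = a * d + - (b * c)

    collin : (L → L) → M2 L → LPair → LPair
    collin η (mat m11 m12 m21 m22) (a , b) =
      (η a * m11 + η b * m21) , (η a * m12 + η b * m22)

    CondI : Pair → Pair → Set
    CondI T U = Σ (L → L) λ η → Σ (M2 L) λ M → IsGal η × det M ≢ 0# ×
      ImageEq Proportional (BSet T) (BSet U) (collin η M)

    CondII : Pair → Pair → Set
    CondII T U = Σ (M2 Fn) λ M → GL2E M ×
      ImageEq SamePoint (LSet T) (LSet U) (λ P → P ·M M)

module Submission where

open import Defs
open import Data.Nat using (ℕ; NonZero; _∸_; _^_; _≤_)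
open import Data.Product using (_×_)
open import Function.Bundles using (_⇔_)
open import Data.Unit using (⊤)

open import Level using (0ℓ)
open import Algebra.Bundles using (CommutativeRing; RawRing)
import Algebra.Solver.Ring.AlmostCommutativeRing as ACR
open import Data.Empty using (⊥; ⊥-elim)
open import Data.Integer as ℤ using (ℤ; -[1+_])
import Data.Integer.Properties as ℤ
open import Data.List using (List; []; _∷_; length; map; filter; cartesianProduct)
open import Data.List.Properties using (length-++; length-map; length-removeAt′; filter-all; filter-accept; filter-reject)
open import Data.List.Membership.Propositional using (_∈_)
open import Data.List.Membership.Propositional.Properties using (∈-cartesianProduct⁻)
import Data.List.Membership.DecPropositional as DecMembership
open import Data.List.Relation.Unary.All as All using (All; []; _∷_)
import Data.List.Relation.Unary.All.Properties as All
open import Data.List.Relation.Unary.AllPairs as AllPairs using (AllPairs; []; _∷_)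
import Data.List.Relation.Unary.AllPairs.Properties as AllPairs
open import Data.List.Relation.Unary.Any as Any using (here; there; _─_)
open import Data.List.Relation.Unary.Unique.Propositional using (Unique)
import Data.List.Relation.Unary.Unique.Propositional.Properties as Unique
open import Data.Maybe using (Maybe; nothing; just)
open import Data.Nat as ℕ using (zero; suc; z≤n; s≤s)
import Data.Nat.Properties as ℕ
open import Data.Product using (Σ; _,_; proj₁; proj₂)
open import Data.Sign as Sign using (Sign)
open import Data.Sum using (_⊎_; inj₁; inj₂)
open import Data.Unit using (tt)
open import Function.Bundles using (mk⇔)
open import Relation.Binary.Definitions using (DecidableEquality)
open import Relation.Binary.PropositionalEquality
open import Relation.Nullary using (¬_; yes; no; Dec; ¬?)
open import Relation.Nullary.Decidable using (decidable-stable)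
open import Relation.Unary using (Pred; Decidable)

-- A projectivity M of PG(1,E) with L_T^M = L_U sends each point E(ρ_a, ρ_b) of L_T to a point
-- E(c u, d u) with u ∈ E*. Choose three points of B(T) normalised to p₁, p₂, p₁ + p₂ and let γ be
-- the unit attached to p₁ + p₂. Additivity of M forces the units of p₁ and p₂ to be scalar
-- multiples of γ, so the image of r p₁ + s p₂ is (γ(r x), γ(s x)) times a fixed invertible
-- matrix C. The y with γ(y x) = e γ(x) form a subfield F_γ ⊇ K. If F_γ = L then γ is semilinear
-- with an automorphism η ∈ Gal(L/K) and M induces the collineation with matrix η(frame⁻¹) C.
-- Otherwise the ratios r/s of the (q^t - 1)/(q - 1) points of the scattered set B(T) are distinct
-- elements of the proper subfield F_γ, whose square size is at most q^t; this forces t = 2 and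
-- F_γ = K, and M induces a linear collineation. Conversely, a collineation with matrix (a_ij) and
-- automorphism η lifts to the projectivity with matrix (η ρ_{a_ij}).

-- Normalising with coefficients in the field itself cannot decide that 1# + - 1# is 0#;
-- integer coefficients compute, so the solver is instantiated along ℤ → L.
module FieldSolver (F : Field) where
  open Field F renaming (Carrier to L)

  commutativeRing : CommutativeRing 0ℓ 0ℓ
  commutativeRing = record { isCommutativeRing = isCommutativeRing }

  open CommutativeRing commutativeRing
    using (+-assoc; +-comm; +-identityˡ; +-identityʳ; -‿inverseʳ; ring; semiring)
  open import Algebra.Properties.Ring ring
    using (-‿distribˡ-*; -‿distribʳ-*; -‿involutive; -0#≈0#; -‿+-comm)
  open import Algebra.Properties.Semiring.Mult.TCOptimised semiring
    using (×-homo-+; ×1-homo-*) renaming (_×_ to _×′_)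
  open ≡-Reasoning

  -- The optimised multiple satisfies 1 ×′ x = x definitionally, so 0 and 1 map to 0# and 1# by refl.
  fromℕ : ℕ → L
  fromℕ n = n ×′ 1#

  signed : Sign → L → L
  signed Sign.+ x = x
  signed Sign.- x = - x

  fromℤ : ℤ → L
  fromℤ (ℤ.+ n) = fromℕ n
  fromℤ -[1+ n ] = - fromℕ (suc n)

  fromℤ-sign : ∀ i → fromℤ i ≡ signed (ℤ.sign i) (fromℕ ℤ.∣ i ∣)
  fromℤ-sign (ℤ.+ n) = refl
  fromℤ-sign -[1+ n ] = refl

  fromℤ-◃ : ∀ s n → fromℤ (s ℤ.◃ n) ≡ signed s (fromℕ n)
  fromℤ-◃ Sign.+ zero = refl
  fromℤ-◃ Sign.- zero = sym -0#≈0#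
  fromℤ-◃ Sign.+ (suc n) = refl
  fromℤ-◃ Sign.- (suc n) = refl

  signed-* : ∀ s t x y → signed s x * signed t y ≡ signed (s Sign.* t) (x * y)
  signed-* Sign.+ Sign.+ x y = refl
  signed-* Sign.+ Sign.- x y = sym (-‿distribʳ-* x y)
  signed-* Sign.- Sign.+ x y = sym (-‿distribˡ-* x y)
  signed-* Sign.- Sign.- x y = begin
    - x * - y     ≡⟨ sym (-‿distribˡ-* x (- y)) ⟩
    - (x * - y)   ≡⟨ cong -_ (sym (-‿distribʳ-* x y)) ⟩
    - - (x * y)   ≡⟨ -‿involutive (x * y) ⟩
    x * y         ∎

  fromℤ-* : ∀ i j → fromℤ (i ℤ.* j) ≡ fromℤ i * fromℤ j
  fromℤ-* i j = begin
    fromℤ (i ℤ.* j)                  ≡⟨ fromℤ-◃ (s Sign.* t) (ℤ.∣ i ∣ ℕ.* ℤ.∣ j ∣) ⟩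
    signed (s Sign.* t) (fromℕ (ℤ.∣ i ∣ ℕ.* ℤ.∣ j ∣))
      ≡⟨ cong (signed (s Sign.* t)) (×1-homo-* ℤ.∣ i ∣ ℤ.∣ j ∣) ⟩
    signed (s Sign.* t) (fromℕ ℤ.∣ i ∣ * fromℕ ℤ.∣ j ∣)
      ≡⟨ sym (signed-* s t _ _) ⟩
    signed s (fromℕ ℤ.∣ i ∣) * signed t (fromℕ ℤ.∣ j ∣)
      ≡⟨ sym (cong₂ _*_ (fromℤ-sign i) (fromℤ-sign j)) ⟩
    fromℤ i * fromℤ j                ∎
    where
    s t : Sign
    s = ℤ.sign i
    t = ℤ.sign j

  fromℕ-suc : ∀ n → fromℕ (suc n) ≡ 1# + fromℕ n
  fromℕ-suc n = ×-homo-+ 1# 1 n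

  fromℤ-⊖ : ∀ m n → fromℤ (m ℤ.⊖ n) ≡ fromℕ m + - fromℕ n
  fromℤ-⊖ zero zero = sym (trans (+-identityˡ _) -0#≈0#)
  fromℤ-⊖ (suc m) zero = sym (trans (cong (fromℕ (suc m) +_) -0#≈0#) (+-identityʳ _))
  fromℤ-⊖ zero (suc n) = sym (+-identityˡ _)
  fromℤ-⊖ (suc m) (suc n) = begin
    fromℤ (suc m ℤ.⊖ suc n)              ≡⟨ cong fromℤ (ℤ.[1+m]⊖[1+n]≡m⊖n m n) ⟩
    fromℤ (m ℤ.⊖ n)                      ≡⟨ fromℤ-⊖ m n ⟩
    fromℕ m + - fromℕ n                  ≡⟨ sym (cancel (fromℕ m) (- fromℕ n)) ⟩
    (1# + fromℕ m) + (- 1# + - fromℕ n)  ≡⟨ cong₂ _+_ (sym (fromℕ-suc m))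
                                              (trans (-‿+-comm 1# (fromℕ n)) (cong -_ (sym (fromℕ-suc n)))) ⟩
    fromℕ (suc m) + - fromℕ (suc n)      ∎
    where
    cancel : ∀ x y → (1# + x) + (- 1# + y) ≡ x + y
    cancel x y = begin
      (1# + x) + (- 1# + y)    ≡⟨ +-assoc 1# x (- 1# + y) ⟩
      1# + (x + (- 1# + y))    ≡⟨ cong (1# +_) (trans (sym (+-assoc x (- 1#) y))
                                   (trans (cong (_+ y) (+-comm x (- 1#))) (+-assoc (- 1#) x y))) ⟩
      1# + (- 1# + (x + y))    ≡⟨ sym (+-assoc 1# (- 1#) (x + y)) ⟩
      (1# + - 1#) + (x + y)    ≡⟨ cong (_+ (x + y)) (-‿inverseʳ 1#) ⟩
      0# + (x + y)             ≡⟨ +-identityˡ (x + y) ⟩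
      x + y                    ∎

  fromℤ-+ : ∀ i j → fromℤ (i ℤ.+ j) ≡ fromℤ i + fromℤ j
  fromℤ-+ (ℤ.+ m) (ℤ.+ n) = ×-homo-+ 1# m n
  fromℤ-+ (ℤ.+ m) -[1+ n ] = fromℤ-⊖ m (suc n)
  fromℤ-+ -[1+ m ] (ℤ.+ n) = trans (fromℤ-⊖ n (suc m)) (+-comm _ _)
  fromℤ-+ -[1+ m ] -[1+ n ] = begin
    - fromℕ (suc (suc (m ℕ.+ n)))        ≡⟨ cong (λ k → - fromℕ k) (sym (ℕ.+-suc (suc m) n)) ⟩
    - fromℕ (suc m ℕ.+ suc n)            ≡⟨ cong -_ (×-homo-+ 1# (suc m) (suc n)) ⟩
    - (fromℕ (suc m) + fromℕ (suc n))    ≡⟨ sym (-‿+-comm _ _) ⟩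
    - fromℕ (suc m) + - fromℕ (suc n)    ∎

  fromℤ-- : ∀ i → fromℤ (ℤ.- i) ≡ - fromℤ i
  fromℤ-- (ℤ.+ zero) = sym -0#≈0#
  fromℤ-- (ℤ.+ suc n) = refl
  fromℤ-- -[1+ n ] = sym (-‿involutive _)

  ℤ-rawRing : RawRing 0ℓ 0ℓ
  ℤ-rawRing = record
    { Carrier = ℤ ; _≈_ = _≡_ ; _+_ = ℤ._+_ ; _*_ = ℤ._*_ ; -_ = ℤ.-_ ; 0# = ℤ.0ℤ ; 1# = ℤ.1ℤ }

  almostCommutativeRing : ACR.AlmostCommutativeRing 0ℓ 0ℓ
  almostCommutativeRing = ACR.fromCommutativeRing commutativeRing

  fromℤ-homomorphism : ℤ-rawRing ACR.-Raw-AlmostCommutative⟶ almostCommutativeRing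
  fromℤ-homomorphism = record
    { ⟦_⟧ = fromℤ ; +-homo = fromℤ-+ ; *-homo = fromℤ-* ; -‿homo = fromℤ--
    ; 0-homo = refl ; 1-homo = refl }

  fromℤ-≡? : ∀ i j → Maybe (fromℤ i ≡ fromℤ j)
  fromℤ-≡? i j with i ℤ.≟ j
  ... | yes i≡j = just (cong fromℤ i≡j)
  ... | no _ = nothing

  open import Algebra.Solver.Ring ℤ-rawRing almostCommutativeRing fromℤ-homomorphism fromℤ-≡? public

module FieldFacts (F : Field) (_≟_ : DecidableEquality (Field.Carrier F)) where
  open Field F renaming (Carrier to L)
  open FieldSolver F public using (solve; _:=_; _:+_; _:*_; :-_; _:-_; con; commutativeRing)
  open import Algebra.Bundles using (CommutativeRing)
  open CommutativeRing commutativeRing public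
    using (+-assoc; +-comm; *-assoc; *-comm; +-identityˡ; +-identityʳ; *-identityˡ; *-identityʳ;
           distribʳ; distribˡ; -‿inverseʳ; -‿inverseˡ; zeroˡ; zeroʳ; ring)
  open import Algebra.Properties.Ring ring public using (-‿distribˡ-*; -0#≈0#)
  open ≡-Reasoning

  1≢0 : 1# ≢ 0#
  1≢0 e = 0≢1 (sym e)

  -- Junk value: 0# ⁻¹ = 0#.
  opaque
    _⁻¹ : L → L
    x ⁻¹ with x ≟ 0#
    ... | yes _ = 0#
    ... | no x≢0 = proj₁ (inverse x x≢0)

    *-inverseʳ : ∀ x → x ≢ 0# → x * x ⁻¹ ≡ 1#
    *-inverseʳ x x≢0 with x ≟ 0#
    ... | yes x≡0 = ⊥-elim (x≢0 x≡0)
    ... | no x≢0′ = proj₂ (inverse x x≢0′)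

    0⁻¹≡0 : 0# ⁻¹ ≡ 0#
    0⁻¹≡0 with 0# ≟ 0#
    ... | yes _ = refl
    ... | no 0≢0 = ⊥-elim (0≢0 refl)

  *-inverseˡ : ∀ x → x ≢ 0# → x ⁻¹ * x ≡ 1#
  *-inverseˡ x x≢0 = trans (*-comm _ _) (*-inverseʳ x x≢0)

  *-cancelˡ : ∀ x {y z} → x ≢ 0# → x * y ≡ x * z → y ≡ z
  *-cancelˡ x {y} {z} x≢0 e = begin
    y                ≡⟨ sym (*-identityˡ y) ⟩
    1# * y           ≡⟨ cong (_* y) (sym (*-inverseˡ x x≢0)) ⟩
    (x ⁻¹ * x) * y   ≡⟨ *-assoc _ _ _ ⟩
    x ⁻¹ * (x * y)   ≡⟨ cong (x ⁻¹ *_) e ⟩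
    x ⁻¹ * (x * z)   ≡⟨ sym (*-assoc _ _ _) ⟩
    (x ⁻¹ * x) * z   ≡⟨ cong (_* z) (*-inverseˡ x x≢0) ⟩
    1# * z           ≡⟨ *-identityˡ z ⟩
    z                ∎

  x*y≡0⇒y≡0 : ∀ {x y} → x * y ≡ 0# → x ≢ 0# → y ≡ 0#
  x*y≡0⇒y≡0 {x} e x≢0 = *-cancelˡ x x≢0 (trans e (sym (zeroʳ x)))

  *-≢0 : ∀ {x y} → x ≢ 0# → y ≢ 0# → x * y ≢ 0#
  *-≢0 x≢0 y≢0 e = y≢0 (x*y≡0⇒y≡0 e x≢0)

  ⁻¹-≢0 : ∀ {x} → x ≢ 0# → x ⁻¹ ≢ 0#
  ⁻¹-≢0 {x} x≢0 e = 1≢0 (trans (sym (*-inverseʳ x x≢0)) (trans (cong (x *_) e) (zeroʳ x)))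

  x*y≡z⇒y≡z*x⁻¹ : ∀ x y z → x ≢ 0# → x * y ≡ z → y ≡ z * x ⁻¹
  x*y≡z⇒y≡z*x⁻¹ x y z x≢0 e = *-cancelˡ x x≢0 (begin
    x * y              ≡⟨ e ⟩
    z                  ≡⟨ sym (*-identityʳ z) ⟩
    z * 1#             ≡⟨ cong (z *_) (sym (*-inverseʳ x x≢0)) ⟩
    z * (x * x ⁻¹)     ≡⟨ solve 3 (λ z x i → z :* (x :* i) := x :* (z :* i)) refl z x (x ⁻¹) ⟩
    x * (z * x ⁻¹)     ∎)

  x≡x*y⁻¹*y : ∀ x y → y ≢ 0# → x ≡ (x * y ⁻¹) * y
  x≡x*y⁻¹*y x y y≢0 = begin
    x                ≡⟨ sym (*-identityʳ x) ⟩
    x * 1#           ≡⟨ cong (x *_) (sym (*-inverseˡ y y≢0)) ⟩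
    x * (y ⁻¹ * y)   ≡⟨ sym (*-assoc _ _ _) ⟩
    (x * y ⁻¹) * y   ∎

  u≡1⇒u*x≡x : ∀ {u} x → u ≡ 1# → u * x ≡ x
  u≡1⇒u*x≡x x u≡1 = trans (cong (_* x) u≡1) (*-identityˡ x)

  u≡0⇒u*x≡0 : ∀ {u} x → u ≡ 0# → u * x ≡ 0#
  u≡0⇒u*x≡0 x u≡0 = trans (cong (_* x) u≡0) (zeroˡ x)

  x+x≡x⇒x≡0 : ∀ {x} → x + x ≡ x → x ≡ 0#
  x+x≡x⇒x≡0 {x} e = begin
    x              ≡⟨ sym (+-identityʳ x) ⟩
    x + 0#         ≡⟨ cong (x +_) (sym (-‿inverseʳ x)) ⟩
    x + (x + - x)  ≡⟨ sym (+-assoc _ _ _) ⟩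
    (x + x) + - x  ≡⟨ cong (_+ - x) e ⟩
    x + - x        ≡⟨ -‿inverseʳ x ⟩
    0#             ∎

  module Additive (f : L → L) (f-+ : ∀ x y → f (x + y) ≡ f x + f y) where

    f-0 : f 0# ≡ 0#
    f-0 = x+x≡x⇒x≡0 (trans (sym (f-+ 0# 0#)) (cong f (+-identityˡ 0#)))

    f-- : ∀ x → f (- x) ≡ - f x
    f-- x = begin
      f (- x)                ≡⟨ solve 2 (λ u v → u := (u :+ v) :+ :- v) refl (f (- x)) (f x) ⟩
      (f (- x) + f x) + - f x ≡⟨ cong (_+ - f x) (sym (f-+ (- x) x)) ⟩
      f (- x + x) + - f x    ≡⟨ cong (λ w → f w + - f x) (-‿inverseˡ x) ⟩
      f 0# + - f x           ≡⟨ cong (_+ - f x) f-0 ⟩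
      0# + - f x             ≡⟨ +-identityˡ _ ⟩
      - f x                  ∎

  +-interchange : ∀ p q r s → (p + q) + (r + s) ≡ (p + r) + (q + s)
  +-interchange = solve 4 (λ p q r s → (p :+ q) :+ (r :+ s) := (p :+ r) :+ (q :+ s)) refl

  det₂ : L → L → L → L → L
  det₂ a b c d = a * d + - (b * c)

  Independent : L × L → L × L → Set
  Independent (a , b) (a′ , b′) = det₂ a b a′ b′ ≢ 0#

  det₂≡0⇒proportional : ∀ a b c d → ¬ (a ≡ 0# × b ≡ 0#) → det₂ a b c d ≡ 0# →
                        Σ L λ l → (c ≡ l * a) × (d ≡ l * b)
  det₂≡0⇒proportional a b c d ab≢0 det≡0 with a ≟ 0#
  ... | no a≢0 = c * a ⁻¹ , x≡x*y⁻¹*y c a a≢0 , *-cancelˡ a a≢0 (begin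
      a * d                  ≡⟨ solve 3 (λ a d bc → a :* d := (a :* d :+ :- bc) :+ bc) refl a d (b * c) ⟩
      det₂ a b c d + b * c   ≡⟨ cong (_+ b * c) det≡0 ⟩
      0# + b * c             ≡⟨ +-identityˡ _ ⟩
      b * c                  ≡⟨ cong (b *_) (x≡x*y⁻¹*y c a a≢0) ⟩
      b * ((c * a ⁻¹) * a)   ≡⟨ solve 3 (λ a b l → b :* (l :* a) := a :* (l :* b)) refl a b (c * a ⁻¹) ⟩
      a * ((c * a ⁻¹) * b)   ∎)
  ... | yes a≡0 = d * b ⁻¹ , c≡ , x≡x*y⁻¹*y d b b≢0
    where
    b≢0 : b ≢ 0#
    b≢0 b≡0 = ab≢0 (a≡0 , b≡0)
    b*c≡0 : b * c ≡ 0#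
    b*c≡0 = begin
      b * c                    ≡⟨ solve 4 (λ a b c d → b :* c := a :* d :+ :- (a :* d :+ :- (b :* c))) refl a b c d ⟩
      a * d + - det₂ a b c d   ≡⟨ cong₂ (λ u v → u * d + - v) a≡0 det≡0 ⟩
      0# * d + - 0#            ≡⟨ solve 1 (λ d → con ℤ.0ℤ :* d :+ :- con ℤ.0ℤ := con ℤ.0ℤ) refl d ⟩
      0#                       ∎
    c≡ : c ≡ (d * b ⁻¹) * a
    c≡ = begin
      c                  ≡⟨ x*y≡0⇒y≡0 b*c≡0 b≢0 ⟩
      0#                 ≡⟨ sym (zeroʳ _) ⟩
      (d * b ⁻¹) * 0#    ≡⟨ cong ((d * b ⁻¹) *_) (sym a≡0) ⟩
      (d * b ⁻¹) * a     ∎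

  module Inverse₂ (a b c d : L) where
    δ : L
    δ = det₂ a b c d ⁻¹
    n₁₁ n₁₂ n₂₁ n₂₂ : L
    n₁₁ = d * δ
    n₁₂ = - b * δ
    n₂₁ = - c * δ
    n₂₂ = a * δ
    AN₁₁ : a * n₁₁ + b * n₂₁ ≡ det₂ a b c d * δ
    AN₁₁ = solve 5 (λ a b c d i → a :* (d :* i) :+ b :* (:- c :* i) := (a :* d :+ :- (b :* c)) :* i) refl a b c d δ
    AN₁₂ : a * n₁₂ + b * n₂₂ ≡ 0#
    AN₁₂ = solve 3 (λ a b i → a :* (:- b :* i) :+ b :* (a :* i) := con ℤ.0ℤ) refl a b δ
    AN₂₁ : c * n₁₁ + d * n₂₁ ≡ 0#
    AN₂₁ = solve 3 (λ c d i → c :* (d :* i) :+ d :* (:- c :* i) := con ℤ.0ℤ) refl c d δ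
    AN₂₂ : c * n₁₂ + d * n₂₂ ≡ det₂ a b c d * δ
    AN₂₂ = solve 5 (λ a b c d i → c :* (:- b :* i) :+ d :* (a :* i) := (a :* d :+ :- (b :* c)) :* i) refl a b c d δ
    NA₁₁ : n₁₁ * a + n₁₂ * c ≡ det₂ a b c d * δ
    NA₁₁ = solve 5 (λ a b c d i → (d :* i) :* a :+ (:- b :* i) :* c := (a :* d :+ :- (b :* c)) :* i) refl a b c d δ
    NA₁₂ : n₁₁ * b + n₁₂ * d ≡ 0#
    NA₁₂ = solve 3 (λ b d i → (d :* i) :* b :+ (:- b :* i) :* d := con ℤ.0ℤ) refl b d δ
    NA₂₁ : n₂₁ * a + n₂₂ * c ≡ 0#
    NA₂₁ = solve 3 (λ a c i → (:- c :* i) :* a :+ (a :* i) :* c := con ℤ.0ℤ) refl a c δ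
    NA₂₂ : n₂₁ * b + n₂₂ * d ≡ det₂ a b c d * δ
    NA₂₂ = solve 5 (λ a b c d i → (:- c :* i) :* b :+ (a :* i) :* d := (a :* d :+ :- (b :* c)) :* i) refl a b c d δ

module Endomorphisms (F : Field) (K : Field.Carrier F → Set) (KS : IsSubfield F K)
                     (_≟_ : DecidableEquality (Field.Carrier F)) where
  open Field F renaming (Carrier to L)
  open FieldFacts F _≟_ public
  open IsSubfield KS public
  open Geometry F K public
  open M2 public
  open ≡-Reasoning

  isLin-0 : ∀ {f} → IsLin f → f 0# ≡ 0#
  isLin-0 {f} (_ , f-scalar) = begin
    f 0#          ≡⟨ cong f (sym (zeroˡ 0#)) ⟩
    f (0# * 0#)   ≡⟨ f-scalar 0# 0# has0 ⟩
    0# * f 0#     ≡⟨ zeroˡ _ ⟩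
    0#            ∎

  isLin-⊙ : ∀ {f g} → IsLin f → IsLin g → IsLin (f ⊙ g)
  isLin-⊙ {f} {g} (f-+ , f-scalar) (g-+ , g-scalar) =
    (λ x y → trans (cong g (f-+ x y)) (g-+ _ _)) ,
    (λ k x k∈K → trans (cong g (f-scalar k x k∈K)) (g-scalar k _ k∈K))

  isLin-ρ : ∀ a → IsLin (ρ a)
  isLin-ρ a = distribˡ a ,
    (λ k x _ → solve 3 (λ a k x → a :* (k :* x) := k :* (a :* x)) refl a k x)

  isLin-id : IsLin idE
  isLin-id = (λ _ _ → refl) , (λ _ _ _ → refl)

  isLin-≈ : ∀ {f g} → f ≈ g → IsLin f → IsLin g
  isLin-≈ f≈g (f-+ , f-scalar) =
    (λ x y → trans (sym (f≈g _)) (trans (f-+ x y) (cong₂ _+_ (f≈g x) (f≈g y)))) ,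
    (λ k x k∈K → trans (sym (f≈g _)) (trans (f-scalar k x k∈K) (cong (k *_) (f≈g x))))

  module _ {γ : Fn} (γ-unit : IsUnit γ) where

    unit-isLin : IsLin γ
    unit-isLin = proj₁ γ-unit

    unit⁻¹ : Fn
    unit⁻¹ = proj₁ (proj₂ γ-unit)

    unit⁻¹-isLin : IsLin unit⁻¹
    unit⁻¹-isLin = proj₁ (proj₂ (proj₂ γ-unit))

    unit⁻¹-after : ∀ x → unit⁻¹ (γ x) ≡ x
    unit⁻¹-after = proj₁ (proj₂ (proj₂ (proj₂ γ-unit)))

    unit⁻¹-before : ∀ x → γ (unit⁻¹ x) ≡ x
    unit⁻¹-before = proj₂ (proj₂ (proj₂ (proj₂ γ-unit)))

    unit⁻¹-isUnit : IsUnit unit⁻¹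
    unit⁻¹-isUnit = unit⁻¹-isLin , γ , unit-isLin , unit⁻¹-before , unit⁻¹-after

    unit-x≡0⇒x≡0 : ∀ {x} → γ x ≡ 0# → x ≡ 0#
    unit-x≡0⇒x≡0 {x} γx≡0 = begin
      x               ≡⟨ sym (unit⁻¹-after x) ⟩
      unit⁻¹ (γ x)    ≡⟨ cong unit⁻¹ γx≡0 ⟩
      unit⁻¹ 0#       ≡⟨ isLin-0 unit⁻¹-isLin ⟩
      0#              ∎

    unit-≢0 : ∀ {x} → x ≢ 0# → γ x ≢ 0#
    unit-≢0 x≢0 γx≡0 = x≢0 (unit-x≡0⇒x≡0 γx≡0)

  unit-⊙ : ∀ {f g} → IsUnit f → IsUnit g → IsUnit (f ⊙ g)
  unit-⊙ {f} {g} f-unit g-unit =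
    isLin-⊙ (unit-isLin f-unit) (unit-isLin g-unit) ,
    (unit⁻¹ g-unit ⊙ unit⁻¹ f-unit) ,
    isLin-⊙ (unit⁻¹-isLin g-unit) (unit⁻¹-isLin f-unit) ,
    (λ x → trans (cong (unit⁻¹ f-unit) (unit⁻¹-after g-unit _)) (unit⁻¹-after f-unit x)) ,
    (λ x → trans (cong g (unit⁻¹-before f-unit _)) (unit⁻¹-before g-unit x))

  unit-id : IsUnit idE
  unit-id = isLin-id , idE , isLin-id , (λ _ → refl) , (λ _ → refl)

  unit-ρ : ∀ {a} → a ≢ 0# → IsUnit (ρ a)
  unit-ρ {a} a≢0 = isLin-ρ a , ρ (a ⁻¹) , isLin-ρ (a ⁻¹) ,
    (λ x → trans (sym (*-assoc _ _ _)) (u≡1⇒u*x≡x x (*-inverseˡ a a≢0))) ,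
    (λ x → trans (sym (*-assoc _ _ _)) (u≡1⇒u*x≡x x (*-inverseʳ a a≢0)))

  samePoint-refl : ∀ P → SamePoint P P
  samePoint-refl P = idE , unit-id , (λ _ → refl) , (λ _ → refl)

  samePoint-sym : ∀ {P Q} → SamePoint P Q → SamePoint Q P
  samePoint-sym {α , β} (γ , γ-unit , γα≈α′ , γβ≈β′) = unit⁻¹ γ-unit , unit⁻¹-isUnit γ-unit ,
    (λ x → trans (sym (γα≈α′ _)) (cong α (unit⁻¹-before γ-unit x))) ,
    (λ x → trans (sym (γβ≈β′ _)) (cong β (unit⁻¹-before γ-unit x)))

  samePoint-trans : ∀ {P Q R} → SamePoint P Q → SamePoint Q R → SamePoint P R
  samePoint-trans (γ , γ-unit , e₁ , e₂) (δ , δ-unit , f₁ , f₂) =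
    (δ ⊙ γ) , unit-⊙ δ-unit γ-unit , (λ x → trans (e₁ _) (f₁ x)) , (λ x → trans (e₂ _) (f₂ x))

  samePoint-scale : ∀ {a b l} → l ≢ 0# → SamePoint (ρ a , ρ b) (ρ (l * a) , ρ (l * b))
  samePoint-scale {a} {b} {l} l≢0 = ρ l , unit-ρ l≢0 ,
    (λ x → solve 3 (λ a l x → a :* (l :* x) := l :* a :* x) refl a l x) ,
    (λ x → solve 3 (λ a l x → a :* (l :* x) := l :* a :* x) refl b l x)

  ρ⊙ρ⊕ρ⊙ρ : ∀ p q r s x → q * (p * x) + s * (r * x) ≡ (p * q + r * s) * x
  ρ⊙ρ⊕ρ⊙ρ = solve 5 (λ p q r s x → q :* (p :* x) :+ s :* (r :* x) := (p :* q :+ r :* s) :* x) refl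

  ρ-matrix-GL2E : ∀ a b c d → det₂ a b c d ≢ 0# → GL2E (mat (ρ a) (ρ b) (ρ c) (ρ d))
  ρ-matrix-GL2E a b c d det≢0 = (isLin-ρ a , isLin-ρ b , isLin-ρ c , isLin-ρ d) ,
    mat (ρ n₁₁) (ρ n₁₂) (ρ n₂₁) (ρ n₂₂) ,
    (isLin-ρ n₁₁ , isLin-ρ n₁₂ , isLin-ρ n₂₁ , isLin-ρ n₂₂) ,
    ((λ x → trans (ρ⊙ρ⊕ρ⊙ρ a n₁₁ b n₂₁ x) (u≡1⇒u*x≡x x (trans AN₁₁ det*δ≡1))) ,
     (λ x → trans (ρ⊙ρ⊕ρ⊙ρ a n₁₂ b n₂₂ x) (u≡0⇒u*x≡0 x AN₁₂)) ,
     (λ x → trans (ρ⊙ρ⊕ρ⊙ρ c n₁₁ d n₂₁ x) (u≡0⇒u*x≡0 x AN₂₁)) ,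
     (λ x → trans (ρ⊙ρ⊕ρ⊙ρ c n₁₂ d n₂₂ x) (u≡1⇒u*x≡x x (trans AN₂₂ det*δ≡1)))) ,
    ((λ x → trans (ρ⊙ρ⊕ρ⊙ρ n₁₁ a n₁₂ c x) (u≡1⇒u*x≡x x (trans NA₁₁ det*δ≡1))) ,
     (λ x → trans (ρ⊙ρ⊕ρ⊙ρ n₁₁ b n₁₂ d x) (u≡0⇒u*x≡0 x NA₁₂)) ,
     (λ x → trans (ρ⊙ρ⊕ρ⊙ρ n₂₁ a n₂₂ c x) (u≡0⇒u*x≡0 x NA₂₁)) ,
     (λ x → trans (ρ⊙ρ⊕ρ⊙ρ n₂₁ b n₂₂ d x) (u≡1⇒u*x≡x x (trans NA₂₂ det*δ≡1))))
    where
    open Inverse₂ a b c d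
    det*δ≡1 : det₂ a b c d * δ ≡ 1#
    det*δ≡1 = *-inverseʳ _ det≢0

  ρ-pair-admissible : ∀ a b → NonZeroPair (a , b) → Admissible (ρ a , ρ b)
  ρ-pair-admissible a b ab≢0 with a ≟ 0#
  ... | no a≢0 = ρ 0# , ρ 1# , ρ-matrix-GL2E a b 0# 1# (λ e → a≢0 (trans
          (sym (solve 2 (λ a b → a :* con (ℤ.+ 1) :+ :- (b :* con ℤ.0ℤ) := a) refl a b)) e))
  ... | yes a≡0 = ρ (- 1#) , ρ 0# , ρ-matrix-GL2E a b (- 1#) 0# (λ e → ab≢0 (a≡0 , trans
          (sym (solve 2 (λ a b → a :* con ℤ.0ℤ :+ :- (b :* :- con (ℤ.+ 1)) := b) refl a b)) e))

  distant-resp-samePoint : ∀ {P Q R} → SamePoint P Q → Distant P R → Distant Q R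
  distant-resp-samePoint {α , β} {α′ , β′} {μ , ν} (γ , γ-unit , γα≈α′ , γβ≈β′)
      ((lα , lβ , lμ , lν) , mat n₁₁ n₁₂ n₂₁ n₂₂ , (l₁₁ , l₁₂ , l₂₁ , l₂₂) ,
       (p₁₁ , p₁₂ , p₂₁ , p₂₂) , (q₁₁ , q₁₂ , q₂₁ , q₂₂)) =
    (isLin-≈ γα≈α′ (isLin-⊙ (unit-isLin γ-unit) lα) ,
     isLin-≈ γβ≈β′ (isLin-⊙ (unit-isLin γ-unit) lβ) , lμ , lν) ,
    mat (n₁₁ ⊙ γ⁻¹) n₁₂ (n₂₁ ⊙ γ⁻¹) n₂₂ ,
    (isLin-⊙ l₁₁ (unit⁻¹-isLin γ-unit) , l₁₂ , isLin-⊙ l₂₁ (unit⁻¹-isLin γ-unit) , l₂₂) ,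
    ((λ x → begin
        γ⁻¹ (n₁₁ (α′ x)) + γ⁻¹ (n₂₁ (β′ x))
          ≡⟨ cong₂ (λ s t → γ⁻¹ (n₁₁ s) + γ⁻¹ (n₂₁ t)) (sym (γα≈α′ x)) (sym (γβ≈β′ x)) ⟩
        γ⁻¹ (n₁₁ (α (γ x))) + γ⁻¹ (n₂₁ (β (γ x)))
          ≡⟨ sym (proj₁ (unit⁻¹-isLin γ-unit) _ _) ⟩
        γ⁻¹ (n₁₁ (α (γ x)) + n₂₁ (β (γ x)))     ≡⟨ cong γ⁻¹ (p₁₁ (γ x)) ⟩
        γ⁻¹ (γ x)                               ≡⟨ unit⁻¹-after γ-unit x ⟩
        x                                       ∎) ,
     (λ x → trans (cong₂ (λ s t → n₁₂ s + n₂₂ t) (sym (γα≈α′ x)) (sym (γβ≈β′ x))) (p₁₂ (γ x))) ,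
     (λ x → trans (sym (proj₁ (unit⁻¹-isLin γ-unit) _ _))
              (trans (cong γ⁻¹ (p₂₁ x)) (isLin-0 (unit⁻¹-isLin γ-unit)))) ,
     p₂₂) ,
    ((λ x → trans (cong (_+ μ (n₁₂ x)) (undo-γ α γα≈α′ _)) (q₁₁ x)) ,
     (λ x → trans (cong (_+ ν (n₁₂ x)) (undo-γ β γβ≈β′ _)) (q₁₂ x)) ,
     (λ x → trans (cong (_+ μ (n₂₂ x)) (undo-γ α γα≈α′ _)) (q₂₁ x)) ,
     (λ x → trans (cong (_+ ν (n₂₂ x)) (undo-γ β γβ≈β′ _)) (q₂₂ x)))
    where
    γ⁻¹ : Fn
    γ⁻¹ = unit⁻¹ γ-unit
    undo-γ : ∀ f {f′} → (γ ⊙ f) ≈ f′ → ∀ y → f′ (γ⁻¹ y) ≡ f y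
    undo-γ f γf≈f′ y = trans (sym (γf≈f′ _)) (cong f (unit⁻¹-before γ-unit y))

  nonDistant-resp-samePoint : ∀ {P Q R} → SamePoint P Q → ¬ Distant Q R → ¬ Distant P R
  nonDistant-resp-samePoint P~Q Q≁R P-R = Q≁R (distant-resp-samePoint P~Q P-R)

  BSet⇒LSet : ∀ {T a b} → BSet T (a , b) → LSet T (ρ a , ρ b)
  BSet⇒LSet {a = a} {b} (ab≢0 , ab≁T) = ρ-pair-admissible a b ab≢0 , (a , b , ab≢0 , samePoint-refl _) , ab≁T

  record ρ-Representative (T X : Pair) : Set where
    field
      a b   : L
      inB   : BSet T (a , b)
      same  : SamePoint (ρ a , ρ b) X

  LSet⇒ρ-Representative : ∀ {T X} → LSet T X → ρ-Representative T X
  LSet⇒ρ-Representative (_ , (a , b , ab≢0 , ab~X) , X≁T) =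
    record { a = a ; b = b ; inB = ab≢0 , nonDistant-resp-samePoint ab~X X≁T ; same = ab~X }

  record Frame (T : Pair) : Set where
    field
      a₁ b₁ a₂ b₂  : L
      p₁∈B         : BSet T (a₁ , b₁)
      p₂∈B         : BSet T (a₂ , b₂)
      p₁+p₂∈B      : BSet T (a₁ + a₂ , b₁ + b₂)
      det≢0        : det₂ a₁ b₁ a₂ b₂ ≢ 0#

module SemilinearMatrices (F : Field) (K : Field.Carrier F → Set) (KS : IsSubfield F K)
                          (_≟_ : DecidableEquality (Field.Carrier F)) where
  open Field F renaming (Carrier to L)
  open Endomorphisms F K KS _≟_
  open ≡-Reasoning

  module Automorphism {η : L → L} (η-gal : IsGal η) where

    η-+ : ∀ x y → η (x + y) ≡ η x + η y
    η-+ = proj₁ η-gal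

    η-* : ∀ x y → η (x * y) ≡ η x * η y
    η-* = proj₁ (proj₂ η-gal)

    η⁻¹ : L → L
    η⁻¹ = proj₁ (proj₁ (proj₂ (proj₂ (proj₂ η-gal))))

    η-η⁻¹ : ∀ x → η (η⁻¹ x) ≡ x
    η-η⁻¹ = proj₁ (proj₂ (proj₁ (proj₂ (proj₂ (proj₂ η-gal)))))

    η⁻¹-η : ∀ x → η⁻¹ (η x) ≡ x
    η⁻¹-η = proj₂ (proj₂ (proj₁ (proj₂ (proj₂ (proj₂ η-gal)))))

    η-fixes-K : ∀ k → K k → η k ≡ k
    η-fixes-K = proj₂ (proj₂ (proj₂ (proj₂ η-gal)))

    η-- : ∀ x → η (- x) ≡ - η x
    η-- = Additive.f-- η η-+

    η⁻¹-+ : ∀ x y → η⁻¹ (x + y) ≡ η⁻¹ x + η⁻¹ y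
    η⁻¹-+ x y = begin
      η⁻¹ (x + y)                 ≡⟨ cong η⁻¹ (cong₂ _+_ (sym (η-η⁻¹ x)) (sym (η-η⁻¹ y))) ⟩
      η⁻¹ (η (η⁻¹ x) + η (η⁻¹ y)) ≡⟨ cong η⁻¹ (sym (η-+ _ _)) ⟩
      η⁻¹ (η (η⁻¹ x + η⁻¹ y))     ≡⟨ η⁻¹-η _ ⟩
      η⁻¹ x + η⁻¹ y               ∎

    η⁻¹-* : ∀ x y → η⁻¹ (x * y) ≡ η⁻¹ x * η⁻¹ y
    η⁻¹-* x y = begin
      η⁻¹ (x * y)                 ≡⟨ cong η⁻¹ (cong₂ _*_ (sym (η-η⁻¹ x)) (sym (η-η⁻¹ y))) ⟩
      η⁻¹ (η (η⁻¹ x) * η (η⁻¹ y)) ≡⟨ cong η⁻¹ (sym (η-* _ _)) ⟩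
      η⁻¹ (η (η⁻¹ x * η⁻¹ y))     ≡⟨ η⁻¹-η _ ⟩
      η⁻¹ x * η⁻¹ y               ∎

    η⁻¹-fixes-K : ∀ k → K k → η⁻¹ k ≡ k
    η⁻¹-fixes-K k k∈K = trans (cong η⁻¹ (sym (η-fixes-K k k∈K))) (η⁻¹-η k)

    η-isLin : IsLin η
    η-isLin = η-+ , (λ k x k∈K → trans (η-* k x) (cong (_* η x) (η-fixes-K k k∈K)))

    η⁻¹-isLin : IsLin η⁻¹
    η⁻¹-isLin = η⁻¹-+ , (λ k x k∈K → trans (η⁻¹-* k x) (cong (_* η⁻¹ x) (η⁻¹-fixes-K k k∈K)))

    η-isUnit : IsUnit η
    η-isUnit = η-isLin , η⁻¹ , η⁻¹-isLin , η⁻¹-η , η-η⁻¹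

    η-ρ-combination : ∀ a b p q x → p * η (a * x) + q * η (b * x) ≡ (η a * p + η b * q) * η x
    η-ρ-combination a b p q x = trans (cong₂ (λ s t → p * s + q * t) (η-* a x) (η-* b x))
      (solve 5 (λ a b p q x → p :* (a :* x) :+ q :* (b :* x) := (a :* p :+ b :* q) :* x) refl
         (η a) (η b) p q (η x))

  id-isGal : IsGal (λ x → x)
  id-isGal = (λ _ _ → refl) , (λ _ _ → refl) , refl , ((λ x → x) , (λ _ → refl) , (λ _ → refl)) , (λ _ _ → refl)

  semilinear-matrix : (L → L) → M2 L → M2 Fn
  semilinear-matrix η (mat A₁₁ A₁₂ A₂₁ A₂₂) = mat (η ⊙ ρ A₁₁) (η ⊙ ρ A₁₂) (η ⊙ ρ A₂₁) (η ⊙ ρ A₂₂)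

  semilinear-matrix-GL2E : ∀ {η} → IsGal η → ∀ A → det A ≢ 0# → GL2E (semilinear-matrix η A)
  semilinear-matrix-GL2E {η} η-gal (mat A₁₁ A₁₂ A₂₁ A₂₂) det≢0 =
    (isLin-⊙ η-isLin (isLin-ρ A₁₁) , isLin-⊙ η-isLin (isLin-ρ A₁₂) ,
     isLin-⊙ η-isLin (isLin-ρ A₂₁) , isLin-⊙ η-isLin (isLin-ρ A₂₂)) ,
    mat (ρ n₁₁ ⊙ η⁻¹) (ρ n₁₂ ⊙ η⁻¹) (ρ n₂₁ ⊙ η⁻¹) (ρ n₂₂ ⊙ η⁻¹) ,
    (isLin-⊙ (isLin-ρ n₁₁) η⁻¹-isLin , isLin-⊙ (isLin-ρ n₁₂) η⁻¹-isLin ,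
     isLin-⊙ (isLin-ρ n₂₁) η⁻¹-isLin , isLin-⊙ (isLin-ρ n₂₂) η⁻¹-isLin) ,
    ((λ y → trans (MN-entry A₁₁ n₁₁ A₁₂ n₂₁ (η y)) (trans (cong η⁻¹ (u≡1⇒u*x≡x (η y) (trans AN₁₁ det*δ≡1))) (η⁻¹-η y))) ,
     (λ y → trans (MN-entry A₁₁ n₁₂ A₁₂ n₂₂ (η y)) (trans (cong η⁻¹ (u≡0⇒u*x≡0 (η y) AN₁₂)) (isLin-0 η⁻¹-isLin))) ,
     (λ y → trans (MN-entry A₂₁ n₁₁ A₂₂ n₂₁ (η y)) (trans (cong η⁻¹ (u≡0⇒u*x≡0 (η y) AN₂₁)) (isLin-0 η⁻¹-isLin))) ,
     (λ y → trans (MN-entry A₂₁ n₁₂ A₂₂ n₂₂ (η y)) (trans (cong η⁻¹ (u≡1⇒u*x≡x (η y) (trans AN₂₂ det*δ≡1))) (η⁻¹-η y)))) ,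
    ((λ y → trans (NM-entry n₁₁ A₁₁ n₁₂ A₂₁ y) (u≡1⇒u*x≡x y (trans NA₁₁ det*δ≡1))) ,
     (λ y → trans (NM-entry n₁₁ A₁₂ n₁₂ A₂₂ y) (u≡0⇒u*x≡0 y NA₁₂)) ,
     (λ y → trans (NM-entry n₂₁ A₁₁ n₂₂ A₂₁ y) (u≡0⇒u*x≡0 y NA₂₁)) ,
     (λ y → trans (NM-entry n₂₁ A₁₂ n₂₂ A₂₂ y) (u≡1⇒u*x≡x y (trans NA₂₂ det*δ≡1))))
    where
    open Automorphism η-gal
    open Inverse₂ A₁₁ A₁₂ A₂₁ A₂₂
    det*δ≡1 : det₂ A₁₁ A₁₂ A₂₁ A₂₂ * δ ≡ 1#
    det*δ≡1 = *-inverseʳ _ det≢0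
    MN-entry : ∀ p q r s z → η⁻¹ (q * (p * z)) + η⁻¹ (s * (r * z)) ≡ η⁻¹ ((p * q + r * s) * z)
    MN-entry p q r s z = trans (sym (η⁻¹-+ _ _)) (cong η⁻¹ (ρ⊙ρ⊕ρ⊙ρ p q r s z))
    NM-entry : ∀ p q r s y → q * η (η⁻¹ (p * y)) + s * η (η⁻¹ (r * y)) ≡ (p * q + r * s) * y
    NM-entry p q r s y = trans (cong₂ (λ u v → q * u + s * v) (η-η⁻¹ _) (η-η⁻¹ _)) (ρ⊙ρ⊕ρ⊙ρ p q r s y)

  collineation⇒projectivity : ∀ T U → CondI T U → CondII T U
  collineation⇒projectivity T U (η , mat A₁₁ A₁₂ A₂₁ A₂₂ , η-gal , det≢0 , T→U , U→T) =
    M , semilinear-matrix-GL2E η-gal (mat A₁₁ A₁₂ A₂₁ A₂₂) det≢0 , L-T→L-U , L-U→L-T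
    where
    open Automorphism η-gal
    M : M2 Fn
    M = semilinear-matrix η (mat A₁₁ A₁₂ A₂₁ A₂₂)

    L-T→L-U : ∀ X → LSet T X → Σ Pair λ Y → LSet U Y × SamePoint Y (X ·M M)
    L-T→L-U X X∈L-T with LSet⇒ρ-Representative X∈L-T
    ... | record { a = a ; b = b ; inB = ab∈B ; same = (v , v-unit , v₁ , v₂) } with T→U (a , b) ab∈B
    ... | (c , d) , cd∈B , (l , l≢0 , c≡ , d≡) =
      (ρ c , ρ d) , BSet⇒LSet cd∈B ,
      ((v ⊙ η) ⊙ ρ l) , unit-⊙ (unit-⊙ v-unit η-isUnit) (unit-ρ l≢0) ,
      (λ x → trans (coordinate c A₁₁ A₂₁ c≡ x) (cong₂ (λ s t → A₁₁ * η s + A₂₁ * η t) (v₁ x) (v₂ x))) ,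
      (λ x → trans (coordinate d A₁₂ A₂₂ d≡ x) (cong₂ (λ s t → A₁₂ * η s + A₂₂ * η t) (v₁ x) (v₂ x)))
      where
      coordinate : ∀ c p q → η a * p + η b * q ≡ l * c → ∀ x →
                   c * (l * η (v x)) ≡ p * η (a * v x) + q * η (b * v x)
      coordinate c p q ηab≡lc x = begin
        c * (l * η (v x))                   ≡⟨ solve 3 (λ c l y → c :* (l :* y) := (l :* c) :* y) refl c l (η (v x)) ⟩
        (l * c) * η (v x)                   ≡⟨ cong (_* η (v x)) (sym ηab≡lc) ⟩
        (η a * p + η b * q) * η (v x)       ≡⟨ sym (η-ρ-combination a b p q (v x)) ⟩
        p * η (a * v x) + q * η (b * v x)   ∎

    L-U→L-T : ∀ Y → LSet U Y → Σ Pair λ X → LSet T X × SamePoint (X ·M M) Y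
    L-U→L-T Y Y∈L-U with LSet⇒ρ-Representative Y∈L-U
    ... | record { a = c ; b = d ; inB = cd∈B ; same = (v , v-unit , v₁ , v₂) } with U→T (c , d) cd∈B
    ... | (a , b) , ab∈B , (l , l≢0 , c≡ , d≡) =
      (ρ a , ρ b) , BSet⇒LSet ab∈B ,
      ((v ⊙ ρ l) ⊙ η⁻¹) , unit-⊙ (unit-⊙ v-unit (unit-ρ l≢0)) (unit⁻¹-isUnit η-isUnit) ,
      (λ x → trans (coordinate c A₁₁ A₂₁ c≡ x) (v₁ x)) ,
      (λ x → trans (coordinate d A₁₂ A₂₂ d≡ x) (v₂ x))
      where
      coordinate : ∀ c p q → c ≡ l * (η a * p + η b * q) → ∀ x →
                   p * η (a * η⁻¹ (l * v x)) + q * η (b * η⁻¹ (l * v x)) ≡ c * v x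
      coordinate c p q c≡lηab x = begin
        p * η (a * η⁻¹ (l * v x)) + q * η (b * η⁻¹ (l * v x))
          ≡⟨ η-ρ-combination a b p q _ ⟩
        (η a * p + η b * q) * η (η⁻¹ (l * v x))   ≡⟨ cong ((η a * p + η b * q) *_) (η-η⁻¹ _) ⟩
        (η a * p + η b * q) * (l * v x)           ≡⟨ solve 3 (λ w l y → w :* (l :* y) := (l :* w) :* y) refl _ l (v x) ⟩
        (l * (η a * p + η b * q)) * v x           ≡⟨ cong (_* v x) (sym c≡lηab) ⟩
        c * v x                                   ∎

module ConjugationField (F : Field) (K : Field.Carrier F → Set) (KS : IsSubfield F K)
                        (_≟_ : DecidableEquality (Field.Carrier F))
                        {γ : Field.Carrier F → Field.Carrier F}
                        (γ-unit : Geometry.IsUnit F K γ) where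
  open Field F renaming (Carrier to L)
  open Endomorphisms F K KS _≟_
  open ≡-Reasoning

  -- These y form the largest subfield over which γ is semilinear.
  ConjugatesToScalar : L → Set
  ConjugatesToScalar y = Σ L λ e → ∀ x → γ (y * x) ≡ e * γ x

  private
    γ-+ : ∀ x y → γ (x + y) ≡ γ x + γ y
    γ-+ = proj₁ (unit-isLin γ-unit)
    γ-scalar : ∀ k x → K k → γ (k * x) ≡ k * γ x
    γ-scalar = proj₂ (unit-isLin γ-unit)

  conj-0 : ConjugatesToScalar 0#
  conj-0 = 0# , λ x → trans (cong γ (zeroˡ x)) (trans (isLin-0 (unit-isLin γ-unit)) (sym (zeroˡ _)))

  conj-+ : ∀ {x y} → ConjugatesToScalar x → ConjugatesToScalar y → ConjugatesToScalar (x + y)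
  conj-+ {x} {y} (e₁ , h₁) (e₂ , h₂) = e₁ + e₂ , λ w → begin
    γ ((x + y) * w)        ≡⟨ cong γ (distribʳ w x y) ⟩
    γ (x * w + y * w)      ≡⟨ γ-+ _ _ ⟩
    γ (x * w) + γ (y * w)  ≡⟨ cong₂ _+_ (h₁ w) (h₂ w) ⟩
    e₁ * γ w + e₂ * γ w    ≡⟨ sym (distribʳ _ _ _) ⟩
    (e₁ + e₂) * γ w        ∎

  conj-- : ∀ {x} → ConjugatesToScalar x → ConjugatesToScalar (- x)
  conj-- {x} (e , h) = - e , λ w → begin
    γ (- x * w)     ≡⟨ cong γ (sym (-‿distribˡ-* x w)) ⟩
    γ (- (x * w))   ≡⟨ Additive.f-- γ γ-+ _ ⟩
    - γ (x * w)     ≡⟨ cong -_ (h w) ⟩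
    - (e * γ w)     ≡⟨ -‿distribˡ-* e (γ w) ⟩
    - e * γ w       ∎

  conj-* : ∀ {x y} → ConjugatesToScalar x → ConjugatesToScalar y → ConjugatesToScalar (x * y)
  conj-* {x} {y} (e₁ , h₁) (e₂ , h₂) = e₁ * e₂ , λ w → begin
    γ ((x * y) * w)     ≡⟨ cong γ (*-assoc x y w) ⟩
    γ (x * (y * w))     ≡⟨ h₁ _ ⟩
    e₁ * γ (y * w)      ≡⟨ cong (e₁ *_) (h₂ w) ⟩
    e₁ * (e₂ * γ w)     ≡⟨ sym (*-assoc _ _ _) ⟩
    (e₁ * e₂) * γ w     ∎

  conj-⁻¹ : ∀ {x} → ConjugatesToScalar x → ConjugatesToScalar (x ⁻¹)
  conj-⁻¹ {x} conj with x ≟ 0#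
  ... | yes x≡0 = subst ConjugatesToScalar (sym (trans (cong _⁻¹ x≡0) 0⁻¹≡0)) conj-0
  ... | no x≢0 = e ⁻¹ , λ w → trans (x*y≡z⇒y≡z*x⁻¹ e _ _ e≢0 (begin
      e * γ (x ⁻¹ * w)      ≡⟨ sym (h _) ⟩
      γ (x * (x ⁻¹ * w))    ≡⟨ cong γ (trans (sym (*-assoc _ _ _)) (u≡1⇒u*x≡x w (*-inverseʳ x x≢0))) ⟩
      γ w                   ∎)) (*-comm _ _)
    where
    e : L
    e = proj₁ conj
    h : ∀ w → γ (x * w) ≡ e * γ w
    h = proj₂ conj
    e≢0 : e ≢ 0#
    e≢0 e≡0 = x≢0 (trans (sym (*-identityʳ x)) (unit-x≡0⇒x≡0 γ-unit (trans (h 1#) (u≡0⇒u*x≡0 _ e≡0))))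

  conj-K : ∀ {k} → K k → ConjugatesToScalar k
  conj-K {k} k∈K = k , λ x → γ-scalar k x k∈K

  conjugable⇒semilinear : (∀ y → ConjugatesToScalar y) →
                          Σ (L → L) λ η → IsGal η × (∀ y x → γ (y * x) ≡ η y * γ x)
  conjugable⇒semilinear conj = η , η-gal , γ-semilinear
    where
    γ1≢0 : γ 1# ≢ 0#
    γ1≢0 = unit-≢0 γ-unit 1≢0
    η : L → L
    η y = γ y * γ 1# ⁻¹
    γ-semilinear : ∀ y x → γ (y * x) ≡ η y * γ x
    γ-semilinear y x = trans (proj₂ (conj y) x) (cong (_* γ x) (x*y≡z⇒y≡z*x⁻¹ (γ 1#) _ (γ y) γ1≢0
      (trans (*-comm _ _) (trans (sym (proj₂ (conj y) 1#)) (cong γ (*-identityʳ y))))))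
    γ⁻¹ : Fn
    γ⁻¹ = unit⁻¹ γ-unit
    η-gal : IsGal η
    η-gal =
      (λ x y → trans (cong (_* γ 1# ⁻¹) (γ-+ x y)) (distribʳ _ _ _)) ,
      (λ x y → trans (cong (_* γ 1# ⁻¹) (γ-semilinear x y)) (*-assoc _ _ _)) ,
      *-inverseʳ _ γ1≢0 ,
      ((λ y → γ⁻¹ (y * γ 1#)) ,
       (λ y → trans (cong (_* γ 1# ⁻¹) (unit⁻¹-before γ-unit _))
                (trans (*-assoc _ _ _) (trans (cong (y *_) (*-inverseʳ _ γ1≢0)) (*-identityʳ y)))) ,
       (λ x → trans (cong γ⁻¹ (trans (*-assoc _ _ _)
                (trans (cong (γ x *_) (*-inverseˡ _ γ1≢0)) (*-identityʳ _)))) (unit⁻¹-after γ-unit x))) ,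
      (λ k k∈K → trans (cong (_* γ 1# ⁻¹) (trans (cong γ (sym (*-identityʳ k))) (γ-scalar k 1# k∈K)))
                   (trans (*-assoc _ _ _) (trans (cong (k *_) (*-inverseʳ _ γ1≢0)) (*-identityʳ k))))

module ProjectivityImages (F : Field) (K : Field.Carrier F → Set) (KS : IsSubfield F K)
                          (_≟_ : DecidableEquality (Field.Carrier F)) where
  open Field F renaming (Carrier to L)
  open Endomorphisms F K KS _≟_
  open ≡-Reasoning

  module Images (T U : Pair) (M : M2 Fn) (M-GL2E : GL2E M)
                (L-T→L-U : ∀ X → LSet T X → Σ Pair λ Y → LSet U Y × SamePoint Y (X ·M M)) where

    image₁ image₂ : L → L → Fn
    image₁ a b x = m11 M (a * x) + m21 M (b * x)
    image₂ a b x = m12 M (a * x) + m22 M (b * x)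

    private
      N : M2 Fn
      N = proj₁ (proj₂ M-GL2E)

      MN≈I : (M ⊗ N) ≈M I2
      MN≈I = proj₁ (proj₂ (proj₂ (proj₂ M-GL2E)))

      IsAdditive : Fn → Set
      IsAdditive f = ∀ x y → f (x + y) ≡ f x + f y

      m₁₁-+ : IsAdditive (m11 M)
      m₁₁-+ = proj₁ (proj₁ (proj₁ M-GL2E))
      m₁₂-+ : IsAdditive (m12 M)
      m₁₂-+ = proj₁ (proj₁ (proj₂ (proj₁ M-GL2E)))
      m₂₁-+ : IsAdditive (m21 M)
      m₂₁-+ = proj₁ (proj₁ (proj₂ (proj₂ (proj₁ M-GL2E))))
      m₂₂-+ : IsAdditive (m22 M)
      m₂₂-+ = proj₁ (proj₂ (proj₂ (proj₂ (proj₁ M-GL2E))))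

      N-lin : LinMat N
      N-lin = proj₁ (proj₂ (proj₂ M-GL2E))

      n₁₁-+ : IsAdditive (m11 N)
      n₁₁-+ = proj₁ (proj₁ N-lin)
      n₁₂-+ : IsAdditive (m12 N)
      n₁₂-+ = proj₁ (proj₁ (proj₂ N-lin))
      n₂₁-+ : IsAdditive (m21 N)
      n₂₁-+ = proj₁ (proj₁ (proj₂ (proj₂ N-lin)))
      n₂₂-+ : IsAdditive (m22 N)
      n₂₂-+ = proj₁ (proj₂ (proj₂ (proj₂ N-lin)))

    N-image₁ : ∀ a b x → m11 N (image₁ a b x) + m21 N (image₂ a b x) ≡ a * x
    N-image₁ a b x = begin
      m11 N (m11 M (a * x) + m21 M (b * x)) + m21 N (m12 M (a * x) + m22 M (b * x))
        ≡⟨ cong₂ _+_ (n₁₁-+ _ _) (n₂₁-+ _ _) ⟩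
      (m11 N (m11 M (a * x)) + m11 N (m21 M (b * x))) + (m21 N (m12 M (a * x)) + m21 N (m22 M (b * x)))
        ≡⟨ +-interchange _ _ _ _ ⟩
      (m11 N (m11 M (a * x)) + m21 N (m12 M (a * x))) + (m11 N (m21 M (b * x)) + m21 N (m22 M (b * x)))
        ≡⟨ cong₂ _+_ (proj₁ MN≈I (a * x)) (proj₁ (proj₂ (proj₂ MN≈I)) (b * x)) ⟩
      a * x + 0#   ≡⟨ +-identityʳ _ ⟩
      a * x        ∎

    N-image₂ : ∀ a b x → m12 N (image₁ a b x) + m22 N (image₂ a b x) ≡ b * x
    N-image₂ a b x = begin
      m12 N (m11 M (a * x) + m21 M (b * x)) + m22 N (m12 M (a * x) + m22 M (b * x))
        ≡⟨ cong₂ _+_ (n₁₂-+ _ _) (n₂₂-+ _ _) ⟩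
      (m12 N (m11 M (a * x)) + m12 N (m21 M (b * x))) + (m22 N (m12 M (a * x)) + m22 N (m22 M (b * x)))
        ≡⟨ +-interchange _ _ _ _ ⟩
      (m12 N (m11 M (a * x)) + m22 N (m12 M (a * x))) + (m12 N (m21 M (b * x)) + m22 N (m22 M (b * x)))
        ≡⟨ cong₂ _+_ (proj₁ (proj₂ MN≈I) (a * x)) (proj₂ (proj₂ (proj₂ MN≈I)) (b * x)) ⟩
      0# + b * x   ≡⟨ +-identityˡ _ ⟩
      b * x        ∎

    image₁-+ : ∀ a₁ b₁ a₂ b₂ y z →
               m11 M (a₁ * y + a₂ * z) + m21 M (b₁ * y + b₂ * z) ≡ image₁ a₁ b₁ y + image₁ a₂ b₂ z
    image₁-+ a₁ b₁ a₂ b₂ y z = trans (cong₂ _+_ (m₁₁-+ _ _) (m₂₁-+ _ _)) (+-interchange _ _ _ _)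

    image₂-+ : ∀ a₁ b₁ a₂ b₂ y z →
               m12 M (a₁ * y + a₂ * z) + m22 M (b₁ * y + b₂ * z) ≡ image₂ a₁ b₁ y + image₂ a₂ b₂ z
    image₂-+ a₁ b₁ a₂ b₂ y z = trans (cong₂ _+_ (m₁₂-+ _ _) (m₂₂-+ _ _)) (+-interchange _ _ _ _)

    record Image (a b : L) : Set where
      field
        u         : Fn
        u-unit    : IsUnit u
        c d       : L
        cd∈B      : BSet U (c , d)
        image₁≡   : ∀ x → image₁ a b x ≡ c * u x
        image₂≡   : ∀ x → image₂ a b x ≡ d * u x

    opaque
      image : ∀ {a b} → BSet T (a , b) → Image a b
      image {a} {b} ab∈B with L-T→L-U (ρ a , ρ b) (BSet⇒LSet ab∈B)
      ... | Y , Y∈L-U , (w , w-unit , w₁ , w₂) with LSet⇒ρ-Representative Y∈L-U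
      ... | record { a = c ; b = d ; inB = cd∈B ; same = (v , v-unit , v₁ , v₂) } = record
        { u = w ⊙ v ; u-unit = unit-⊙ w-unit v-unit ; c = c ; d = d ; cd∈B = cd∈B
        ; image₁≡ = λ x → trans (sym (w₁ x)) (sym (v₁ (w x)))
        ; image₂≡ = λ x → trans (sym (w₂ x)) (sym (v₂ (w x))) }

    image-det≡0⇒det≡0 : ∀ {a b a′ b′} (I : Image a b) (I′ : Image a′ b′) →
                        det₂ (Image.c I) (Image.d I) (Image.c I′) (Image.d I′) ≡ 0# → det₂ a b a′ b′ ≡ 0#
    image-det≡0⇒det≡0 {a} {b} {a′} {b′} I I′ det≡0
      with det₂≡0⇒proportional (Image.c I) (Image.d I) (Image.c I′) (Image.d I′) (proj₁ (Image.cd∈B I)) det≡0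
    ... | l , c′≡lc , d′≡ld = begin
        a * b′ + - (b * a′)                 ≡⟨ cong₂ (λ s t → a * s + - (b * t)) (sym (*-identityʳ b′)) (sym (*-identityʳ a′)) ⟩
        a * (b′ * 1#) + - (b * (a′ * 1#))   ≡⟨ cong₂ (λ s t → a * s + - (b * t)) b′≡by a′≡ay ⟩
        a * (b * y) + - (b * (a * y))       ≡⟨ solve 3 (λ a b y → a :* (b :* y) :+ :- (b :* (a :* y)) := con ℤ.0ℤ) refl a b y ⟩
        0#                                  ∎
      where
      open Image I
      u′ : Fn
      u′ = Image.u I′
      y : L
      y = unit⁻¹ u-unit (l * u′ 1#)
      rescale : ∀ {w} e → w ≡ l * e → w * u′ 1# ≡ e * u y
      rescale {w} e w≡le = begin
        w * u′ 1#          ≡⟨ cong (_* u′ 1#) w≡le ⟩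
        (l * e) * u′ 1#    ≡⟨ solve 3 (λ l e v → (l :* e) :* v := e :* (l :* v)) refl l e (u′ 1#) ⟩
        e * (l * u′ 1#)    ≡⟨ cong (e *_) (sym (unit⁻¹-before u-unit _)) ⟩
        e * u y            ∎
      same-images : ∀ (f g : Fn) →
        f (image₁ a′ b′ 1#) + g (image₂ a′ b′ 1#) ≡ f (image₁ a b y) + g (image₂ a b y)
      same-images f g = cong₂ (λ s t → f s + g t)
        (trans (Image.image₁≡ I′ 1#) (trans (rescale c c′≡lc) (sym (image₁≡ y))))
        (trans (Image.image₂≡ I′ 1#) (trans (rescale d d′≡ld) (sym (image₂≡ y))))
      a′≡ay : a′ * 1# ≡ a * y
      a′≡ay = trans (sym (N-image₁ a′ b′ 1#)) (trans (same-images (m11 N) (m21 N)) (N-image₁ a b y))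
      b′≡by : b′ * 1# ≡ b * y
      b′≡by = trans (sym (N-image₂ a′ b′ 1#)) (trans (same-images (m12 N) (m22 N)) (N-image₂ a b y))

    module InFrame (φ : Frame T) where
      open Frame φ

      private
        I₁ : Image a₁ b₁
        I₁ = image p₁∈B
        I₂ : Image a₂ b₂
        I₂ = image p₂∈B
        I₃ : Image (a₁ + a₂) (b₁ + b₂)
        I₃ = image p₁+p₂∈B
        u₁ u₂ : Fn
        u₁ = Image.u I₁
        u₂ = Image.u I₂
        c₁ d₁ c₂ d₂ c₃ d₃ : L
        c₁ = Image.c I₁
        d₁ = Image.d I₁
        c₂ = Image.c I₂
        d₂ = Image.d I₂
        c₃ = Image.c I₃
        d₃ = Image.d I₃

      γ : Fn
      γ = Image.u I₃

      γ-unit : IsUnit γ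
      γ-unit = Image.u-unit I₃

      private
        c₃γ≡ : ∀ x → c₃ * γ x ≡ c₁ * u₁ x + c₂ * u₂ x
        c₃γ≡ x = begin
          c₃ * γ x                                       ≡⟨ sym (Image.image₁≡ I₃ x) ⟩
          m11 M ((a₁ + a₂) * x) + m21 M ((b₁ + b₂) * x)  ≡⟨ cong₂ (λ s t → m11 M s + m21 M t) (distribʳ x a₁ a₂) (distribʳ x b₁ b₂) ⟩
          m11 M (a₁ * x + a₂ * x) + m21 M (b₁ * x + b₂ * x) ≡⟨ image₁-+ a₁ b₁ a₂ b₂ x x ⟩
          image₁ a₁ b₁ x + image₁ a₂ b₂ x                ≡⟨ cong₂ _+_ (Image.image₁≡ I₁ x) (Image.image₁≡ I₂ x) ⟩
          c₁ * u₁ x + c₂ * u₂ x                          ∎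

        d₃γ≡ : ∀ x → d₃ * γ x ≡ d₁ * u₁ x + d₂ * u₂ x
        d₃γ≡ x = begin
          d₃ * γ x                                       ≡⟨ sym (Image.image₂≡ I₃ x) ⟩
          m12 M ((a₁ + a₂) * x) + m22 M ((b₁ + b₂) * x)  ≡⟨ cong₂ (λ s t → m12 M s + m22 M t) (distribʳ x a₁ a₂) (distribʳ x b₁ b₂) ⟩
          m12 M (a₁ * x + a₂ * x) + m22 M (b₁ * x + b₂ * x) ≡⟨ image₂-+ a₁ b₁ a₂ b₂ x x ⟩
          image₂ a₁ b₁ x + image₂ a₂ b₂ x                ≡⟨ cong₂ _+_ (Image.image₂≡ I₁ x) (Image.image₂≡ I₂ x) ⟩
          d₁ * u₁ x + d₂ * u₂ x                          ∎

        D D₁ D₂ : L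
        D = det₂ c₁ d₁ c₂ d₂
        D₁ = det₂ c₃ d₃ c₂ d₂
        D₂ = det₂ c₁ d₁ c₃ d₃

        D≢0 : D ≢ 0#
        D≢0 D≡0 = det≢0 (image-det≡0⇒det≡0 I₁ I₂ D≡0)

        D₁≢0 : D₁ ≢ 0#
        D₁≢0 D₁≡0 = det≢0 (trans
          (solve 4 (λ a₁ b₁ a₂ b₂ → a₁ :* b₂ :+ :- (b₁ :* a₂) := (a₁ :+ a₂) :* b₂ :+ :- ((b₁ :+ b₂) :* a₂)) refl a₁ b₁ a₂ b₂)
          (image-det≡0⇒det≡0 I₃ I₂ D₁≡0))

        D₂≢0 : D₂ ≢ 0#
        D₂≢0 D₂≡0 = det≢0 (trans
          (solve 4 (λ a₁ b₁ a₂ b₂ → a₁ :* b₂ :+ :- (b₁ :* a₂) := a₁ :* (b₁ :+ b₂) :+ :- (b₁ :* (a₁ :+ a₂))) refl a₁ b₁ a₂ b₂)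
          (image-det≡0⇒det≡0 I₁ I₃ D₂≡0))

        cramer₁ : ∀ w A B → c₃ * w ≡ c₁ * A + c₂ * B → d₃ * w ≡ d₁ * A + d₂ * B → D * A ≡ D₁ * w
        cramer₁ w A B e₁ e₂ = sym (begin
          (c₃ * d₂ + - (d₃ * c₂)) * w       ≡⟨ solve 5 (λ c₃ d₃ c₂ d₂ w → (c₃ :* d₂ :+ :- (d₃ :* c₂)) :* w := d₂ :* (c₃ :* w) :+ :- (c₂ :* (d₃ :* w))) refl c₃ d₃ c₂ d₂ w ⟩
          d₂ * (c₃ * w) + - (c₂ * (d₃ * w)) ≡⟨ cong₂ (λ s t → d₂ * s + - (c₂ * t)) e₁ e₂ ⟩
          d₂ * (c₁ * A + c₂ * B) + - (c₂ * (d₁ * A + d₂ * B))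
            ≡⟨ solve 6 (λ c₁ d₁ c₂ d₂ A B → d₂ :* (c₁ :* A :+ c₂ :* B) :+ :- (c₂ :* (d₁ :* A :+ d₂ :* B)) := (c₁ :* d₂ :+ :- (d₁ :* c₂)) :* A) refl c₁ d₁ c₂ d₂ A B ⟩
          (c₁ * d₂ + - (d₁ * c₂)) * A       ∎)

        cramer₂ : ∀ w A B → c₃ * w ≡ c₁ * A + c₂ * B → d₃ * w ≡ d₁ * A + d₂ * B → D * B ≡ D₂ * w
        cramer₂ w A B e₁ e₂ = sym (begin
          (c₁ * d₃ + - (d₁ * c₃)) * w       ≡⟨ solve 5 (λ c₁ d₁ c₃ d₃ w → (c₁ :* d₃ :+ :- (d₁ :* c₃)) :* w := c₁ :* (d₃ :* w) :+ :- (d₁ :* (c₃ :* w))) refl c₁ d₁ c₃ d₃ w ⟩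
          c₁ * (d₃ * w) + - (d₁ * (c₃ * w)) ≡⟨ cong₂ (λ s t → c₁ * s + - (d₁ * t)) e₂ e₁ ⟩
          c₁ * (d₁ * A + d₂ * B) + - (d₁ * (c₁ * A + c₂ * B))
            ≡⟨ solve 6 (λ c₁ d₁ c₂ d₂ A B → c₁ :* (d₁ :* A :+ d₂ :* B) :+ :- (d₁ :* (c₁ :* A :+ c₂ :* B)) := (c₁ :* d₂ :+ :- (d₁ :* c₂)) :* B) refl c₁ d₁ c₂ d₂ A B ⟩
          (c₁ * d₂ + - (d₁ * c₂)) * B       ∎)

        ν₁ ν₂ : L
        ν₁ = D₁ * D ⁻¹
        ν₂ = D₂ * D ⁻¹

        ν₁≢0 : ν₁ ≢ 0#
        ν₁≢0 = *-≢0 D₁≢0 (⁻¹-≢0 D≢0)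

        ν₂≢0 : ν₂ ≢ 0#
        ν₂≢0 = *-≢0 D₂≢0 (⁻¹-≢0 D≢0)

        swap : ∀ n g i → (n * g) * i ≡ (n * i) * g
        swap = solve 3 (λ n g i → (n :* g) :* i := (n :* i) :* g) refl

        -- Images of independent points are independent (D ≢ 0), so Cramer's rule applied to
        -- c₃γ≡ and d₃γ≡ makes u₁ and u₂ scalar multiples of γ.
        u₁≡ν₁γ : ∀ x → u₁ x ≡ ν₁ * γ x
        u₁≡ν₁γ x = trans (x*y≡z⇒y≡z*x⁻¹ D (u₁ x) (D₁ * γ x) D≢0 (cramer₁ (γ x) (u₁ x) (u₂ x) (c₃γ≡ x) (d₃γ≡ x))) (swap _ _ _)

        u₂≡ν₂γ : ∀ x → u₂ x ≡ ν₂ * γ x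
        u₂≡ν₂γ x = trans (x*y≡z⇒y≡z*x⁻¹ D (u₂ x) (D₂ * γ x) D≢0 (cramer₂ (γ x) (u₁ x) (u₂ x) (c₃γ≡ x) (d₃γ≡ x))) (swap _ _ _)

      C₁₁ C₁₂ C₂₁ C₂₂ : L
      C₁₁ = c₁ * ν₁
      C₁₂ = d₁ * ν₁
      C₂₁ = c₂ * ν₂
      C₂₂ = d₂ * ν₂

      detC≢0 : det₂ C₁₁ C₁₂ C₂₁ C₂₂ ≢ 0#
      detC≢0 e = *-≢0 (*-≢0 ν₁≢0 ν₂≢0) D≢0 (trans
        (solve 6 (λ c₁ d₁ c₂ d₂ n₁ n₂ → (n₁ :* n₂) :* (c₁ :* d₂ :+ :- (d₁ :* c₂)) := (c₁ :* n₁) :* (d₂ :* n₂) :+ :- ((d₁ :* n₁) :* (c₂ :* n₂))) refl c₁ d₁ c₂ d₂ ν₁ ν₂)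
        e)

      open Inverse₂ a₁ b₁ a₂ b₂ public

      private
        det*δ≡1 : det₂ a₁ b₁ a₂ b₂ * δ ≡ 1#
        det*δ≡1 = *-inverseʳ _ det≢0

      r s : L → L → L
      r a b = a * n₁₁ + b * n₂₁
      s a b = a * n₁₂ + b * n₂₂

      a≡ra₁+sa₂ : ∀ a b → a ≡ r a b * a₁ + s a b * a₂
      a≡ra₁+sa₂ a b = sym (begin
        (a * n₁₁ + b * n₂₁) * a₁ + (a * n₁₂ + b * n₂₂) * a₂
          ≡⟨ solve 8 (λ a b p q r s a₁ a₂ → (a :* p :+ b :* r) :* a₁ :+ (a :* q :+ b :* s) :* a₂ := a :* (p :* a₁ :+ q :* a₂) :+ b :* (r :* a₁ :+ s :* a₂)) refl a b n₁₁ n₁₂ n₂₁ n₂₂ a₁ a₂ ⟩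
        a * (n₁₁ * a₁ + n₁₂ * a₂) + b * (n₂₁ * a₁ + n₂₂ * a₂) ≡⟨ cong₂ (λ s t → a * s + b * t) (trans NA₁₁ det*δ≡1) NA₂₁ ⟩
        a * 1# + b * 0#   ≡⟨ solve 2 (λ a b → a :* con (ℤ.+ 1) :+ b :* con ℤ.0ℤ := a) refl a b ⟩
        a                 ∎)

      b≡rb₁+sb₂ : ∀ a b → b ≡ r a b * b₁ + s a b * b₂
      b≡rb₁+sb₂ a b = sym (begin
        (a * n₁₁ + b * n₂₁) * b₁ + (a * n₁₂ + b * n₂₂) * b₂
          ≡⟨ solve 8 (λ a b p q r s a₁ a₂ → (a :* p :+ b :* r) :* a₁ :+ (a :* q :+ b :* s) :* a₂ := a :* (p :* a₁ :+ q :* a₂) :+ b :* (r :* a₁ :+ s :* a₂)) refl a b n₁₁ n₁₂ n₂₁ n₂₂ b₁ b₂ ⟩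
        a * (n₁₁ * b₁ + n₁₂ * b₂) + b * (n₂₁ * b₁ + n₂₂ * b₂) ≡⟨ cong₂ (λ s t → a * s + b * t) NA₁₂ (trans NA₂₂ det*δ≡1) ⟩
        a * 0# + b * 1#   ≡⟨ solve 2 (λ a b → a :* con ℤ.0ℤ :+ b :* con (ℤ.+ 1) := b) refl a b ⟩
        b                 ∎)

      private
        split : ∀ a a₁ a₂ r s x → a ≡ r * a₁ + s * a₂ → a * x ≡ a₁ * (r * x) + a₂ * (s * x)
        split a a₁ a₂ r s x a≡ = trans (cong (_* x) a≡)
          (solve 5 (λ a₁ a₂ r s x → (r :* a₁ :+ s :* a₂) :* x := a₁ :* (r :* x) :+ a₂ :* (s :* x)) refl a₁ a₂ r s x)

      image₁-in-frame : ∀ a b x → image₁ a b x ≡ C₁₁ * γ (r a b * x) + C₂₁ * γ (s a b * x)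
      image₁-in-frame a b x = begin
        m11 M (a * x) + m21 M (b * x)
          ≡⟨ cong₂ (λ s t → m11 M s + m21 M t) (split a a₁ a₂ r′ s′ x (a≡ra₁+sa₂ a b)) (split b b₁ b₂ r′ s′ x (b≡rb₁+sb₂ a b)) ⟩
        m11 M (a₁ * (r′ * x) + a₂ * (s′ * x)) + m21 M (b₁ * (r′ * x) + b₂ * (s′ * x))  ≡⟨ image₁-+ a₁ b₁ a₂ b₂ _ _ ⟩
        image₁ a₁ b₁ (r′ * x) + image₁ a₂ b₂ (s′ * x)      ≡⟨ cong₂ _+_ (Image.image₁≡ I₁ _) (Image.image₁≡ I₂ _) ⟩
        c₁ * u₁ (r′ * x) + c₂ * u₂ (s′ * x)                ≡⟨ cong₂ (λ p q → c₁ * p + c₂ * q) (u₁≡ν₁γ _) (u₂≡ν₂γ _) ⟩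
        c₁ * (ν₁ * γ (r′ * x)) + c₂ * (ν₂ * γ (s′ * x))    ≡⟨ cong₂ _+_ (sym (*-assoc _ _ _)) (sym (*-assoc _ _ _)) ⟩
        C₁₁ * γ (r′ * x) + C₂₁ * γ (s′ * x)                ∎
        where
        r′ s′ : L
        r′ = r a b
        s′ = s a b

      image₂-in-frame : ∀ a b x → image₂ a b x ≡ C₁₂ * γ (r a b * x) + C₂₂ * γ (s a b * x)
      image₂-in-frame a b x = begin
        m12 M (a * x) + m22 M (b * x)
          ≡⟨ cong₂ (λ s t → m12 M s + m22 M t) (split a a₁ a₂ r′ s′ x (a≡ra₁+sa₂ a b)) (split b b₁ b₂ r′ s′ x (b≡rb₁+sb₂ a b)) ⟩
        m12 M (a₁ * (r′ * x) + a₂ * (s′ * x)) + m22 M (b₁ * (r′ * x) + b₂ * (s′ * x))  ≡⟨ image₂-+ a₁ b₁ a₂ b₂ _ _ ⟩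
        image₂ a₁ b₁ (r′ * x) + image₂ a₂ b₂ (s′ * x)      ≡⟨ cong₂ _+_ (Image.image₂≡ I₁ _) (Image.image₂≡ I₂ _) ⟩
        d₁ * u₁ (r′ * x) + d₂ * u₂ (s′ * x)                ≡⟨ cong₂ (λ p q → d₁ * p + d₂ * q) (u₁≡ν₁γ _) (u₂≡ν₂γ _) ⟩
        d₁ * (ν₁ * γ (r′ * x)) + d₂ * (ν₂ * γ (s′ * x))    ≡⟨ cong₂ _+_ (sym (*-assoc _ _ _)) (sym (*-assoc _ _ _)) ⟩
        C₁₂ * γ (r′ * x) + C₂₂ * γ (s′ * x)                ∎
        where
        r′ s′ : L
        r′ = r a b
        s′ = s a b

      open ConjugationField F K KS _≟_ γ-unit public

      module AtPoint {a b : L} (ab∈B : BSet T (a , b)) where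
        private
          I : Image a b
          I = image ab∈B
          c d r′ s′ f e : L
          c = Image.c I
          d = Image.d I
          r′ = r a b
          s′ = s a b
          f = C₁₁ * d + - (C₁₂ * c)
          e = C₂₂ * c + - (C₂₁ * d)

          -- Eliminating u from (c u, d u) = (C₁₁ γ(r·) + C₂₁ γ(s·), C₁₂ γ(r·) + C₂₂ γ(s·)).
          fγr≡eγs : ∀ x → f * γ (r′ * x) ≡ e * γ (s′ * x)
          fγr≡eγs x = begin
            f * p
              ≡⟨ solve 8 (λ C₁₁ C₁₂ C₂₁ C₂₂ c d p q → (C₁₁ :* d :+ :- (C₁₂ :* c)) :* p := (C₂₂ :* c :+ :- (C₂₁ :* d)) :* q :+ (d :* (C₁₁ :* p :+ C₂₁ :* q) :+ :- (c :* (C₁₂ :* p :+ C₂₂ :* q)))) refl C₁₁ C₁₂ C₂₁ C₂₂ c d p q ⟩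
            e * q + (d * (C₁₁ * p + C₂₁ * q) + - (c * (C₁₂ * p + C₂₂ * q)))
              ≡⟨ cong₂ (λ s t → e * q + (d * s + - (c * t)))
                   (trans (sym (image₁-in-frame a b x)) (Image.image₁≡ I x))
                   (trans (sym (image₂-in-frame a b x)) (Image.image₂≡ I x)) ⟩
            e * q + (d * (c * ux) + - (c * (d * ux)))
              ≡⟨ solve 4 (λ w c d ux → w :+ (d :* (c :* ux) :+ :- (c :* (d :* ux))) := w) refl (e * q) c d ux ⟩
            e * q ∎
            where
            p q ux : L
            p = γ (r′ * x)
            q = γ (s′ * x)
            ux = Image.u I x

          fe≢0 : ¬ (f ≡ 0# × e ≡ 0#)
          fe≢0 (f≡0 , e≡0) = proj₁ (Image.cd∈B I) (c≡0 , d≡0)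
            where
            c≡0 : c ≡ 0#
            c≡0 = x*y≡0⇒y≡0 (begin
              det₂ C₁₁ C₁₂ C₂₁ C₂₂ * c
                ≡⟨ solve 6 (λ C₁₁ C₁₂ C₂₁ C₂₂ c d → (C₁₁ :* C₂₂ :+ :- (C₁₂ :* C₂₁)) :* c := C₁₁ :* (C₂₂ :* c :+ :- (C₂₁ :* d)) :+ C₂₁ :* (C₁₁ :* d :+ :- (C₁₂ :* c))) refl C₁₁ C₁₂ C₂₁ C₂₂ c d ⟩
              C₁₁ * e + C₂₁ * f    ≡⟨ cong₂ (λ u v → C₁₁ * u + C₂₁ * v) e≡0 f≡0 ⟩
              C₁₁ * 0# + C₂₁ * 0#  ≡⟨ solve 2 (λ x y → x :* con ℤ.0ℤ :+ y :* con ℤ.0ℤ := con ℤ.0ℤ) refl C₁₁ C₂₁ ⟩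
              0#                   ∎) detC≢0
            d≡0 : d ≡ 0#
            d≡0 = x*y≡0⇒y≡0 (begin
              det₂ C₁₁ C₁₂ C₂₁ C₂₂ * d
                ≡⟨ solve 6 (λ C₁₁ C₁₂ C₂₁ C₂₂ c d → (C₁₁ :* C₂₂ :+ :- (C₁₂ :* C₂₁)) :* d := C₂₂ :* (C₁₁ :* d :+ :- (C₁₂ :* c)) :+ C₁₂ :* (C₂₂ :* c :+ :- (C₂₁ :* d))) refl C₁₁ C₁₂ C₂₁ C₂₂ c d ⟩
              C₂₂ * f + C₁₂ * e    ≡⟨ cong₂ (λ u v → C₂₂ * u + C₁₂ * v) f≡0 e≡0 ⟩
              C₂₂ * 0# + C₁₂ * 0#  ≡⟨ solve 2 (λ x y → x :* con ℤ.0ℤ :+ y :* con ℤ.0ℤ := con ℤ.0ℤ) refl C₂₂ C₁₂ ⟩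
              0#                   ∎) detC≢0

          f≢0 : s′ ≢ 0# → f ≢ 0#
          f≢0 s′≢0 f≡0 = s′≢0 (trans (sym (*-identityʳ s′)) (unit-x≡0⇒x≡0 γ-unit (x*y≡0⇒y≡0 eγs≡0 e≢0)))
            where
            e≢0 : e ≢ 0#
            e≢0 e≡0 = fe≢0 (f≡0 , e≡0)
            eγs≡0 : e * γ (s′ * 1#) ≡ 0#
            eγs≡0 = trans (sym (fγr≡eγs 1#)) (u≡0⇒u*x≡0 _ f≡0)

        coordinates≢0 : ¬ (r a b ≡ 0# × s a b ≡ 0#)
        coordinates≢0 (r≡0 , s≡0) = proj₁ ab∈B
          (trans (a≡ra₁+sa₂ a b) (vanish a₁ a₂) , trans (b≡rb₁+sb₂ a b) (vanish b₁ b₂))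
          where
          vanish : ∀ u v → r a b * u + s a b * v ≡ 0#
          vanish u v = trans (cong₂ (λ p q → p * u + q * v) r≡0 s≡0)
            (solve 2 (λ u v → con ℤ.0ℤ :* u :+ con ℤ.0ℤ :* v := con ℤ.0ℤ) refl u v)

        ratio-conjugable : s a b ≢ 0# → ConjugatesToScalar (r a b * s a b ⁻¹)
        ratio-conjugable s′≢0 = e * f ⁻¹ , λ y → begin
          γ ((r′ * s′ ⁻¹) * y)              ≡⟨ cong γ (*-assoc _ _ _) ⟩
          γ (r′ * (s′ ⁻¹ * y))              ≡⟨ x*y≡z⇒y≡z*x⁻¹ f _ _ (f≢0 s′≢0) (fγr≡eγs (s′ ⁻¹ * y)) ⟩
          (e * γ (s′ * (s′ ⁻¹ * y))) * f ⁻¹ ≡⟨ cong (λ w → (e * γ w) * f ⁻¹) (trans (sym (*-assoc _ _ _)) (u≡1⇒u*x≡x y (*-inverseʳ s′ s′≢0))) ⟩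
          (e * γ y) * f ⁻¹                  ≡⟨ swap _ _ _ ⟩
          (e * f ⁻¹) * γ y                  ∎

      divide-by : ∀ {w} → w ≢ 0# → Fn
      divide-by {w} _ x = w ⁻¹ * γ (w * x)

      scaled-unit : ∀ {w} (w≢0 : w ≢ 0#) → IsUnit (divide-by w≢0)
      scaled-unit {w} w≢0 = unit-⊙ (unit-⊙ (unit-ρ w≢0) γ-unit) (unit-ρ (⁻¹-≢0 w≢0))

      γ-rescaled : ∀ {w} (w≢0 : w ≢ 0#) x → γ (w * x) ≡ w * divide-by w≢0 x
      γ-rescaled {w} w≢0 x = sym (trans (sym (*-assoc _ _ _)) (u≡1⇒u*x≡x _ (*-inverseʳ w w≢0)))

      SemilinearOn : (L → L) → L → L → Set
      SemilinearOn η a b = Σ Fn λ g → IsUnit g ×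
        (∀ x → γ (r a b * x) ≡ η (r a b) * g x) × (∀ x → γ (s a b * x) ≡ η (s a b) * g x)

      γ-semilinear⇒SemilinearOn : ∀ {η} → (∀ y x → γ (y * x) ≡ η y * γ x) → ∀ a b → SemilinearOn η a b
      γ-semilinear⇒SemilinearOn γ-semilinear a b = γ , γ-unit , γ-semilinear (r a b) , γ-semilinear (s a b)

      -- With η the identity: the ratio r/s lies in K, so it commutes with γ.
      conjugable-in-K⇒SemilinearOn : (∀ y → ConjugatesToScalar y → K y) →
                                     ∀ {a b} → BSet T (a , b) → SemilinearOn (λ x → x) a b
      conjugable-in-K⇒SemilinearOn conj⇒K {a} {b} ab∈B with s a b ≟ 0#
      ... | yes s′≡0 = divide-by r′≢0 , scaled-unit r′≢0 , γ-rescaled r′≢0 , γs′≡s′g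
        where
        open AtPoint ab∈B
        r′≢0 : r a b ≢ 0#
        r′≢0 r′≡0 = coordinates≢0 (r′≡0 , s′≡0)
        γs′≡s′g : ∀ x → γ (s a b * x) ≡ s a b * divide-by r′≢0 x
        γs′≡s′g x = begin
          γ (s a b * x)               ≡⟨ cong (λ w → γ (w * x)) s′≡0 ⟩
          γ (0# * x)                  ≡⟨ cong γ (zeroˡ x) ⟩
          γ 0#                        ≡⟨ isLin-0 (unit-isLin γ-unit) ⟩
          0#                          ≡⟨ sym (u≡0⇒u*x≡0 _ s′≡0) ⟩
          s a b * divide-by r′≢0 x    ∎
      ... | no s′≢0 = divide-by s′≢0 , scaled-unit s′≢0 , γr′≡r′g , γ-rescaled s′≢0
        where
        open AtPoint ab∈B
        r′ s′ λ′ : L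
        r′ = r a b
        s′ = s a b
        λ′ = r′ * s′ ⁻¹
        λ′∈K : K λ′
        λ′∈K = conj⇒K λ′ (ratio-conjugable s′≢0)
        γr′≡r′g : ∀ x → γ (r′ * x) ≡ r′ * divide-by s′≢0 x
        γr′≡r′g x = begin
          γ (r′ * x)                     ≡⟨ cong γ (sym (ratio-times x)) ⟩
          γ (λ′ * (s′ * x))              ≡⟨ proj₂ (unit-isLin γ-unit) λ′ (s′ * x) λ′∈K ⟩
          λ′ * γ (s′ * x)                ≡⟨ cong (λ′ *_) (γ-rescaled s′≢0 x) ⟩
          λ′ * (s′ * divide-by s′≢0 x)   ≡⟨ ratio-times _ ⟩
          r′ * divide-by s′≢0 x          ∎
          where
          ratio-times : ∀ y → λ′ * (s′ * y) ≡ r′ * y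
          ratio-times y = begin
            λ′ * (s′ * y)            ≡⟨ solve 4 (λ r i s y → (r :* i) :* (s :* y) := r :* y :* (i :* s)) refl r′ (s′ ⁻¹) s′ y ⟩
            r′ * y * (s′ ⁻¹ * s′)    ≡⟨ cong (r′ * y *_) (*-inverseˡ s′ s′≢0) ⟩
            r′ * y * 1#              ≡⟨ *-identityʳ _ ⟩
            r′ * y                   ∎

      det-n≢0 : det₂ n₁₁ n₁₂ n₂₁ n₂₂ ≢ 0#
      det-n≢0 e = 0≢1 (begin
        0#                                     ≡⟨ sym (zeroˡ _) ⟩
        0# * det₂ a₁ b₁ a₂ b₂                  ≡⟨ cong (_* det₂ a₁ b₁ a₂ b₂) (sym e) ⟩
        det₂ n₁₁ n₁₂ n₂₁ n₂₂ * det₂ a₁ b₁ a₂ b₂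
          ≡⟨ solve 8 (λ p q r s a₁ b₁ a₂ b₂ → (p :* s :+ :- (q :* r)) :* (a₁ :* b₂ :+ :- (b₁ :* a₂)) := (p :* a₁ :+ q :* a₂) :* (r :* b₁ :+ s :* b₂) :+ :- ((p :* b₁ :+ q :* b₂) :* (r :* a₁ :+ s :* a₂))) refl n₁₁ n₁₂ n₂₁ n₂₂ a₁ b₁ a₂ b₂ ⟩
        (n₁₁ * a₁ + n₁₂ * a₂) * (n₂₁ * b₁ + n₂₂ * b₂) + - ((n₁₁ * b₁ + n₁₂ * b₂) * (n₂₁ * a₁ + n₂₂ * a₂))
          ≡⟨ cong₂ (λ u v → u * v + - ((n₁₁ * b₁ + n₁₂ * b₂) * (n₂₁ * a₁ + n₂₂ * a₂))) (trans NA₁₁ det*δ≡1) (trans NA₂₂ det*δ≡1) ⟩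
        1# * 1# + - ((n₁₁ * b₁ + n₁₂ * b₂) * (n₂₁ * a₁ + n₂₂ * a₂)) ≡⟨ cong₂ (λ u v → 1# * 1# + - (u * v)) NA₁₂ NA₂₁ ⟩
        1# * 1# + - (0# * 0#)                  ≡⟨ solve 0 (con (ℤ.+ 1) :* con (ℤ.+ 1) :+ :- (con ℤ.0ℤ :* con ℤ.0ℤ) := con (ℤ.+ 1)) refl ⟩
        1#                                     ∎)

      private
        s≢0 : L × L → Set
        s≢0 p = s (proj₁ p) (proj₂ p) ≢ 0#

        s≢0? : Decidable s≢0
        s≢0? p = ¬? (s (proj₁ p) (proj₂ p) ≟ 0#)

        ratio : L × L → L
        ratio p = r (proj₁ p) (proj₂ p) * s (proj₁ p) (proj₂ p) ⁻¹

        coordinates-independent : ∀ {p p′} → Independent p p′ →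
          det₂ (r (proj₁ p) (proj₂ p)) (s (proj₁ p) (proj₂ p)) (r (proj₁ p′) (proj₂ p′)) (s (proj₁ p′) (proj₂ p′)) ≢ 0#
        coordinates-independent {a , b} {a′ , b′} p⊥p′ e = *-≢0 p⊥p′ det-n≢0 (trans
          (sym (solve 8 (λ a b a′ b′ p q r s → (a :* p :+ b :* r) :* (a′ :* q :+ b′ :* s) :+ :- ((a :* q :+ b :* s) :* (a′ :* p :+ b′ :* r)) := (a :* b′ :+ :- (b :* a′)) :* (p :* s :+ :- (q :* r))) refl a b a′ b′ n₁₁ n₁₂ n₂₁ n₂₂))
          e)

        both-s≡0⇒dependent : ∀ {p p′} → Independent p p′ → ¬ s≢0 p → s (proj₁ p′) (proj₂ p′) ≡ 0# → ⊥
        both-s≡0⇒dependent {p} {p′} p⊥p′ s≡0 s′≡0 = coordinates-independent {p} {p′} p⊥p′ (begin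
          r₁ * s₂ + - (s₁ * r₂)   ≡⟨ cong₂ (λ u v → r₁ * v + - (u * r₂)) (decidable-stable (_ ≟ 0#) s≡0) s′≡0 ⟩
          r₁ * 0# + - (0# * r₂)    ≡⟨ solve 2 (λ r r′ → r :* con ℤ.0ℤ :+ :- (con ℤ.0ℤ :* r′) := con ℤ.0ℤ) refl r₁ r₂ ⟩
          0#                        ∎)
          where
          r₁ s₁ r₂ s₂ : L
          r₁ = r (proj₁ p) (proj₂ p)
          s₁ = s (proj₁ p) (proj₂ p)
          r₂ = r (proj₁ p′) (proj₂ p′)
          s₂ = s (proj₁ p′) (proj₂ p′)

        equal-ratios⇒dependent : ∀ {p p′} → s≢0 p → s≢0 p′ → ratio p ≡ ratio p′ → Independent p p′ → ⊥
        equal-ratios⇒dependent {p} {p′} sp≢0 sp′≢0 ratio≡ p⊥p′ = coordinates-independent {p} {p′} p⊥p′ (begin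
          r₁ * s₂ + - (s₁ * r₂)                        ≡⟨ cong (λ w → w * s₂ + - (s₁ * r₂)) (x≡x*y⁻¹*y r₁ s₁ sp≢0) ⟩
          (r₁ * s₁ ⁻¹) * s₁ * s₂ + - (s₁ * r₂)           ≡⟨ cong (λ w → w * s₁ * s₂ + - (s₁ * r₂)) ratio≡ ⟩
          (r₂ * s₂ ⁻¹) * s₁ * s₂ + - (s₁ * r₂)         ≡⟨ solve 4 (λ r′ i s s′ → (r′ :* i) :* s :* s′ :+ :- (s :* r′) := s :* r′ :* (i :* s′ :- con (ℤ.+ 1))) refl r₂ (s₂ ⁻¹) s₁ s₂ ⟩
          s₁ * r₂ * (s₂ ⁻¹ * s₂ + - 1#)               ≡⟨ cong (λ w → s₁ * r₂ * (w + - 1#)) (*-inverseˡ s₂ sp′≢0) ⟩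
          s₁ * r₂ * (1# + - 1#)                       ≡⟨ solve 2 (λ u v → u :* v :* (con (ℤ.+ 1) :- con (ℤ.+ 1)) := con ℤ.0ℤ) refl s₁ r₂ ⟩
          0#                                         ∎)
          where
          r₁ s₁ r₂ s₂ : L
          r₁ = r (proj₁ p) (proj₂ p)
          s₁ = s (proj₁ p) (proj₂ p)
          r₂ = r (proj₁ p′) (proj₂ p′)
          s₂ = s (proj₁ p′) (proj₂ p′)

      ratios : List (L × L) → List L
      ratios ps = map ratio (filter s≢0? ps)

      ratios-unique : ∀ {ps} → AllPairs Independent ps → Unique (ratios ps)
      ratios-unique {ps} ps-independent = AllPairs.map⁺ (distinct (All.all-filter s≢0? ps) (AllPairs.filter⁺ s≢0? ps-independent))
        where
        distinct : ∀ {qs} → All s≢0 qs → AllPairs Independent qs → AllPairs (λ p p′ → ratio p ≢ ratio p′) qs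
        distinct [] [] = []
        distinct (sp≢0 ∷ sps≢0) (p⊥qs ∷ qs-independent) =
          All.zipWith (λ (sp′≢0 , p⊥p′) ratio≡ → equal-ratios⇒dependent sp≢0 sp′≢0 ratio≡ p⊥p′) (sps≢0 , p⊥qs)
          ∷ distinct sps≢0 qs-independent

      length≤1+length-ratios : ∀ {ps} → AllPairs Independent ps → length ps ℕ.≤ suc (length (ratios ps))
      length≤1+length-ratios {[]} [] = z≤n
      length≤1+length-ratios {p ∷ ps} (p⊥ps ∷ ps-independent) with s≢0? p
      ... | yes sp≢0 rewrite filter-accept s≢0? {p} {ps} sp≢0 = s≤s (length≤1+length-ratios ps-independent)
      ... | no sp≡0 rewrite filter-reject s≢0? {p} {ps} sp≡0 = s≤s (ℕ.≤-reflexive (begin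
        length ps                  ≡⟨ cong length (sym (filter-all s≢0? others-s≢0)) ⟩
        length (filter s≢0? ps)    ≡⟨ sym (length-map ratio (filter s≢0? ps)) ⟩
        length (ratios ps)         ∎))
        where
        others-s≢0 : All s≢0 ps
        others-s≢0 = All.map (λ p⊥p′ sp′≡0 → both-s≡0⇒dependent p⊥p′ sp≡0 sp′≡0) p⊥ps

      ratios-conjugable : ∀ {ps} → All (BSet T) ps → All ConjugatesToScalar (ratios ps)
      ratios-conjugable {ps} ps∈B = All.map⁺ (All.zipWith (λ (sp≢0 , p∈B) → AtPoint.ratio-conjugable p∈B sp≢0)
                                                (All.all-filter s≢0? ps , All.filter⁺ s≢0? ps∈B))

      module Collineation {η : L → L} (η-gal : IsGal η) where
        open SemilinearMatrices.Automorphism F K KS _≟_ η-gal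

        M₀ : M2 L
        M₀ = mat (η n₁₁ * C₁₁ + η n₁₂ * C₂₁) (η n₁₁ * C₁₂ + η n₁₂ * C₂₂)
                 (η n₂₁ * C₁₁ + η n₂₂ * C₂₁) (η n₂₁ * C₁₂ + η n₂₂ * C₂₂)

        private
          η-r : ∀ a b → η (r a b) ≡ η a * η n₁₁ + η b * η n₂₁
          η-r a b = trans (η-+ _ _) (cong₂ _+_ (η-* _ _) (η-* _ _))

          η-s : ∀ a b → η (s a b) ≡ η a * η n₁₂ + η b * η n₂₂
          η-s a b = trans (η-+ _ _) (cong₂ _+_ (η-* _ _) (η-* _ _))

          collin-entry : ∀ a b p q →
            η a * (η n₁₁ * p + η n₁₂ * q) + η b * (η n₂₁ * p + η n₂₂ * q) ≡ η (r a b) * p + η (s a b) * q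
          collin-entry a b p q = sym (trans (cong₂ (λ u v → u * p + v * q) (η-r a b) (η-s a b))
            (solve 8 (λ x y u v w z p q → (x :* u :+ y :* w) :* p :+ (x :* v :+ y :* z) :* q := x :* (u :* p :+ v :* q) :+ y :* (w :* p :+ z :* q)) refl
               (η a) (η b) (η n₁₁) (η n₁₂) (η n₂₁) (η n₂₂) p q))

          semilinear-combination : ∀ {a b} ((g , _ , γr≡ , γs≡) : SemilinearOn η a b) P Q x →
            P * γ (r a b * x) + Q * γ (s a b * x) ≡ (η (r a b) * P + η (s a b) * Q) * g x
          semilinear-combination {a} {b} (g , _ , γr≡ , γs≡) P Q x =
            trans (cong₂ (λ u v → P * u + Q * v) (γr≡ x) (γs≡ x))
              (solve 5 (λ P Q u v g → P :* (u :* g) :+ Q :* (v :* g) := (u :* P :+ v :* Q) :* g) refl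
                 P Q (η (r a b)) (η (s a b)) (g x))

        image₁-collin : ∀ {a b} (sl : SemilinearOn η a b) x →
                        image₁ a b x ≡ proj₁ (collin η M₀ (a , b)) * proj₁ sl x
        image₁-collin {a} {b} sl x = trans (image₁-in-frame a b x)
          (trans (semilinear-combination sl C₁₁ C₂₁ x) (cong (_* proj₁ sl x) (sym (collin-entry a b C₁₁ C₂₁))))

        image₂-collin : ∀ {a b} (sl : SemilinearOn η a b) x →
                        image₂ a b x ≡ proj₂ (collin η M₀ (a , b)) * proj₁ sl x
        image₂-collin {a} {b} sl x = trans (image₂-in-frame a b x)
          (trans (semilinear-combination sl C₁₂ C₂₂ x) (cong (_* proj₁ sl x) (sym (collin-entry a b C₁₂ C₂₂))))

        det-M₀≢0 : det M₀ ≢ 0#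
        det-M₀≢0 e = *-≢0 (unit-≢0 η-isUnit det-n≢0) detC≢0 (begin
          η (det₂ n₁₁ n₁₂ n₂₁ n₂₂) * det₂ C₁₁ C₁₂ C₂₁ C₂₂
            ≡⟨ cong (_* det₂ C₁₁ C₁₂ C₂₁ C₂₂) (trans (η-+ _ _) (cong₂ _+_ (η-* _ _) (trans (η-- _) (cong -_ (η-* _ _))))) ⟩
          det₂ (η n₁₁) (η n₁₂) (η n₂₁) (η n₂₂) * det₂ C₁₁ C₁₂ C₂₁ C₂₂
            ≡⟨ solve 8 (λ p q r s C₁₁ C₁₂ C₂₁ C₂₂ → (p :* s :+ :- (q :* r)) :* (C₁₁ :* C₂₂ :+ :- (C₁₂ :* C₂₁)) := (p :* C₁₁ :+ q :* C₂₁) :* (r :* C₁₂ :+ s :* C₂₂) :+ :- ((p :* C₁₂ :+ q :* C₂₂) :* (r :* C₁₁ :+ s :* C₂₁))) refl (η n₁₁) (η n₁₂) (η n₂₁) (η n₂₂) C₁₁ C₁₂ C₂₁ C₂₂ ⟩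
          det M₀   ≡⟨ e ⟩
          0#       ∎)

        image-proportional : ∀ {a b} (sl : SemilinearOn η a b) (I : Image a b) →
                             Proportional (Image.c I , Image.d I) (collin η M₀ (a , b))
        image-proportional {a} {b} sl@(g , g-unit , _) I =
          u x₀ , unit-≢0 (Image.u-unit I) x₀≢0 ,
          coefficient (image₁-collin sl) (Image.image₁≡ I) ,
          coefficient (image₂-collin sl) (Image.image₂≡ I)
          where
          open Image I using (u)
          x₀ : L
          x₀ = unit⁻¹ g-unit 1#
          gx₀≡1 : g x₀ ≡ 1#
          gx₀≡1 = unit⁻¹-before g-unit 1#
          x₀≢0 : x₀ ≢ 0#
          x₀≢0 x₀≡0 = 1≢0 (trans (sym gx₀≡1) (trans (cong g x₀≡0) (isLin-0 (unit-isLin g-unit))))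
          coefficient : ∀ {f : Fn} {col e} → (∀ x → f x ≡ col * g x) → (∀ x → f x ≡ e * u x) → col ≡ u x₀ * e
          coefficient {f} {col} {e} f≡colg f≡eu = begin
            col            ≡⟨ sym (*-identityʳ col) ⟩
            col * 1#       ≡⟨ cong (col *_) (sym gx₀≡1) ⟩
            col * g x₀     ≡⟨ sym (f≡colg x₀) ⟩
            f x₀           ≡⟨ f≡eu x₀ ⟩
            e * u x₀       ≡⟨ *-comm _ _ ⟩
            u x₀ * e       ∎

        preimage-proportional :
          (L-U→L-T : ∀ Y → LSet U Y → Σ Pair λ X → LSet T X × SamePoint (X ·M M) Y) →
          (∀ {a b} → BSet T (a , b) → SemilinearOn η a b) →
          ∀ Q → BSet U Q → Σ LPair λ P → BSet T P × Proportional (collin η M₀ P) Q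
        preimage-proportional L-U→L-T semilinear (c , d) cd∈B
          with L-U→L-T (ρ c , ρ d) (BSet⇒LSet cd∈B)
        ... | X , X∈L-T , (w , w-unit , w₁ , w₂) with LSet⇒ρ-Representative X∈L-T
        ... | record { a = a ; b = b ; inB = ab∈B ; same = (v , v-unit , v₁ , v₂) } =
          (a , b) , ab∈B , k , unit-≢0 (unit-⊙ (unit-⊙ w-unit v-unit) g-unit) 1≢0 ,
          coefficient {m11 M} {m21 M} (image₁-collin sl (v (w 1#))) w₁ ,
          coefficient {m12 M} {m22 M} (image₂-collin sl (v (w 1#))) w₂
          where
          sl : SemilinearOn η a b
          sl = semilinear ab∈B
          g : Fn
          g = proj₁ sl
          g-unit : IsUnit g
          g-unit = proj₁ (proj₂ sl)
          k : L
          k = g (v (w 1#))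
          coefficient : ∀ {mA mB : Fn} {col e} →
            mA (a * v (w 1#)) + mB (b * v (w 1#)) ≡ col * k →
            (∀ x → mA (proj₁ X (w x)) + mB (proj₂ X (w x)) ≡ e * x) → e ≡ k * col
          coefficient {mA} {mB} {col} {e} image≡ wX≡ = begin
            e                                            ≡⟨ sym (*-identityʳ e) ⟩
            e * 1#                                       ≡⟨ sym (wX≡ 1#) ⟩
            mA (proj₁ X (w 1#)) + mB (proj₂ X (w 1#))    ≡⟨ cong₂ (λ s t → mA s + mB t) (sym (v₁ _)) (sym (v₂ _)) ⟩
            mA (a * v (w 1#)) + mB (b * v (w 1#))        ≡⟨ image≡ ⟩
            col * k                                      ≡⟨ *-comm _ _ ⟩
            k * col                                      ∎

        collineation :
          (L-U→L-T : ∀ Y → LSet U Y → Σ Pair λ X → LSet T X × SamePoint (X ·M M) Y) →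
          (∀ {a b} → BSet T (a , b) → SemilinearOn η a b) → CondI T U
        collineation L-U→L-T semilinear =
          η , M₀ , η-gal , det-M₀≢0 ,
          (λ P P∈B → let I = image P∈B in
             (Image.c I , Image.d I) , Image.cd∈B I , image-proportional (semilinear P∈B) I) ,
          preimage-proportional L-U→L-T semilinear

∈-─ : ∀ {A : Set} {x y : A} {ys : List A} (x∈ys : x ∈ ys) → y ∈ ys → y ≢ x → y ∈ (ys ─ x∈ys)
∈-─ (here refl) (here refl) y≢x = ⊥-elim (y≢x refl)
∈-─ (here refl) (there y∈ys) _ = y∈ys
∈-─ (there _) (here y≡z) _ = here y≡z
∈-─ (there x∈ys) (there y∈ys) y≢x = there (∈-─ x∈ys y∈ys y≢x)

injection⇒length-≤ : ∀ {A B : Set} (f : A → B) (S : A → Set) (xs : List A) (ys : List B) →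
                     AllPairs _≢_ xs → All S xs → (∀ {x y} → S x → S y → f x ≡ f y → x ≡ y) →
                     All (λ x → f x ∈ ys) xs → length xs ≤ length ys
injection⇒length-≤ f S [] ys _ _ _ _ = z≤n
injection⇒length-≤ f S (x ∷ xs) ys (x∉xs ∷ xs!) (Sx All.∷ Sxs) f-inj (fx∈ys All.∷ fxs∈ys) =
  subst (suc (length xs) ≤_) (sym (length-removeAt′ ys _))
    (s≤s (injection⇒length-≤ f S xs (ys ─ fx∈ys) xs! Sxs f-inj
      (All.zipWith (λ { ((x≢y , Sy) , fy∈ys) → ∈-─ fx∈ys fy∈ys (λ fy≡fx → x≢y (f-inj Sx Sy (sym fy≡fx))) })
        (All.zip (x∉xs , Sxs) , fxs∈ys))))

length-cartesianProduct : ∀ {A B : Set} (xs : List A) (ys : List B) →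
                          length (cartesianProduct xs ys) ≡ length xs ℕ.* length ys
length-cartesianProduct [] ys = refl
length-cartesianProduct (x ∷ xs) ys =
  trans (length-++ (map (x ,_) ys)) (cong₂ ℕ._+_ (length-map (x ,_) ys) (length-cartesianProduct xs ys))

-- q = p + 2, so that q ∸ 1 = suc p and (q ^ suc t ∸ 1) / suc p = |PG(t, q)|.
module PowerCounts (p : ℕ) where
  open import Data.Nat
  open import Data.Nat.Properties
  open import Data.Nat.DivMod using (_/_; m*n/n≡m; /-monoˡ-≤)

  private
    q : ℕ
    q = suc (suc p)

  q≤q^ : ∀ t → 1 ≤ t → q ≤ q ^ t
  q≤q^ t 1≤t = subst (_≤ q ^ t) (*-identityʳ q) (^-monoʳ-≤ q 1≤t)

  q^t<θ : ∀ t → 1 ≤ t → suc (q ^ t) ≤ (q ^ suc t ∸ 1) / suc p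
  q^t<θ t 1≤t = subst (_≤ (q ^ suc t ∸ 1) / suc p) (m*n/n≡m (suc (q ^ t)) (suc p))
                  (/-monoˡ-≤ (suc p) (subst (_≤ q ^ suc t ∸ 1) (*-comm (suc p) (suc Q))
                    (subst (_≤ q ^ suc t ∸ 1) (m+n∸n≡m (suc p * suc Q) 1) (∸-monoˡ-≤ 1 bound))))
    where
    Q : ℕ
    Q = q ^ t
    bound : suc p * suc Q + 1 ≤ q * Q
    bound = begin
      suc p * suc Q + 1          ≡⟨ cong (_+ 1) (*-suc (suc p) Q) ⟩
      (suc p + suc p * Q) + 1    ≡⟨ +-comm (suc p + suc p * Q) 1 ⟩
      q + suc p * Q              ≤⟨ +-monoˡ-≤ (suc p * Q) (q≤q^ t 1≤t) ⟩
      Q + suc p * Q              ∎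
      where open ≤-Reasoning

  3≤θ : ∀ t → 1 ≤ t → 3 ≤ (q ^ suc t ∸ 1) / suc p
  3≤θ t 1≤t = ≤-trans (s≤s (≤-trans (s≤s (s≤s z≤n)) (q≤q^ t 1≤t))) (q^t<θ t 1≤t)

  θ≤1+n⇒n²≤q^t⇒t≡1 : ∀ t n → 1 ≤ t → (q ^ suc t ∸ 1) / suc p ≤ suc n → n * n ≤ q ^ suc t → t ≡ 1
  θ≤1+n⇒n²≤q^t⇒t≡1 (suc zero) n _ _ _ = refl
  θ≤1+n⇒n²≤q^t⇒t≡1 (suc (suc t)) n 1≤t θ≤1+n n²≤q^t = ⊥-elim (<⇒≱ q<Q Q≤q)
    where
    Q : ℕ
    Q = q ^ suc (suc t)
    instance
      Q≢0 : NonZero Q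
      Q≢0 = >-nonZero (m^n>0 q (suc (suc t)))
    Q≤n : Q ≤ n
    Q≤n = s≤s⁻¹ (≤-trans (q^t<θ (suc (suc t)) 1≤t) θ≤1+n)
    Q≤q : Q ≤ q
    Q≤q = *-cancelʳ-≤ Q q Q (≤-trans (*-mono-≤ Q≤n Q≤n) n²≤q^t)
    q<Q : q < Q
    q<Q = begin-strict
      q                    ≡⟨ sym (*-identityʳ q) ⟩
      q * 1                <⟨ *-monoʳ-< q {1} {2} (s≤s (s≤s z≤n)) ⟩
      q * 2                ≤⟨ *-monoʳ-≤ q (≤-trans (s≤s (s≤s z≤n)) (q≤q^ (suc t) (s≤s z≤n))) ⟩
      q * (q * q ^ t)      ∎
      where open ≤-Reasoning

  [1+q]²≰q² : ¬ (suc q * suc q ≤ q ^ 2)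
  [1+q]²≰q² h = <⇒≱ (s≤s (≤-trans (*-monoʳ-≤ q (n≤1+n q)) (m≤n+m (q * suc q) q)))
                  (subst (suc q * suc q ≤_) (cong (q *_) (*-identityʳ q)) h)

module Enumeration {A : Set} (xs : List A) (xs-complete : ∀ x → x ∈ xs) where

  ≟-from-unique : Unique xs → DecidableEquality A
  ≟-from-unique unique x y = go unique (xs-complete x) (xs-complete y)
    where
    go : ∀ {ys} → Unique ys → x ∈ ys → y ∈ ys → Dec (x ≡ y)
    go _ (here x≡z) (here y≡z) = yes (trans x≡z (sym y≡z))
    go (z∉ys ∷ _) (here x≡z) (there y∈ys) = no (λ x≡y → All.lookup z∉ys y∈ys (trans (sym x≡z) x≡y))
    go (z∉ys ∷ _) (there x∈ys) (here y≡z) = no (λ x≡y → All.lookup z∉ys x∈ys (sym (trans x≡y y≡z)))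
    go (_ ∷ ys!) (there x∈ys) (there y∈ys) = go ys! x∈ys y∈ys

  ∃? : ∀ {P : Pred A 0ℓ} → Decidable P → Dec (Σ A P)
  ∃? P? with Any.any? P? xs
  ... | yes ∃P = yes (Any.satisfied ∃P)
  ... | no ∄P = no (λ (x , Px) → ∄P (Any.map (λ { refl → Px }) (xs-complete x)))

  ∀? : ∀ {P : Pred A 0ℓ} → Decidable P → Dec (∀ x → P x)
  ∀? P? with All.all? P? xs
  ... | yes ∀P = yes (λ x → All.lookup ∀P (xs-complete x))
  ... | no ¬∀P = no (λ ∀P → ¬∀P (All.tabulate (λ {x} _ → ∀P x)))

  ∀-or-counterexample : ∀ {P : Pred A 0ℓ} → Decidable P → (∀ x → P x) ⊎ Σ A (λ z → ¬ P z)
  ∀-or-counterexample P? with ∃? (λ x → ¬? (P? x))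
  ... | yes counterexample = inj₂ counterexample
  ... | no ∄ = inj₁ (λ x → decidable-stable (P? x) (λ ¬Px → ∄ (x , ¬Px)))

module FiniteConjugation (F : Field) (K : Field.Carrier F → Set) (KS : IsSubfield F K)
                         (_≟_ : DecidableEquality (Field.Carrier F))
                         (Ls : List (Field.Carrier F)) (Ls-complete : ∀ x → x ∈ Ls)
                         {γ : Field.Carrier F → Field.Carrier F}
                         (γ-unit : Geometry.IsUnit F K γ) where
  open Field F renaming (Carrier to L)
  open Endomorphisms F K KS _≟_
  open ConjugationField F K KS _≟_ γ-unit
  open ≡-Reasoning

  ConjugatesToScalar? : Decidable ConjugatesToScalar
  ConjugatesToScalar? y = ∃? (λ e → ∀? (λ x → γ (y * x) ≟ (e * γ x)))
    where open Enumeration Ls Ls-complete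

  module _ (z : L) (z-not-conj : ¬ ConjugatesToScalar z) where

    private
      Conj² : L × L → Set
      Conj² (a , b) = ConjugatesToScalar a × ConjugatesToScalar b

      a+bz : L × L → L
      a+bz (a , b) = a + b * z

      -- a + b z = a′ + b′ z with b ≢ b′ would put z = (a′ - a) / (b - b′) in the subfield.
      a+bz-injective : ∀ {p p′} → Conj² p → Conj² p′ → a+bz p ≡ a+bz p′ → p ≡ p′
      a+bz-injective {a , b} {a′ , b′} (a-conj , b-conj) (a′-conj , b′-conj) e with b ≟ b′
      ... | yes refl = cong (_, b) (begin
        a                        ≡⟨ solve 2 (λ a w → a := (a :+ w) :+ :- w) refl a (b * z) ⟩
        (a + b * z) + - (b * z)  ≡⟨ cong (_+ - (b * z)) e ⟩
        (a′ + b * z) + - (b * z) ≡⟨ solve 2 (λ a w → (a :+ w) :+ :- w := a) refl a′ (b * z) ⟩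
        a′                       ∎)
      ... | no b≢b′ = ⊥-elim (z-not-conj (subst ConjugatesToScalar (sym z≡)
              (conj-* (conj-+ a′-conj (conj-- a-conj)) (conj-⁻¹ (conj-+ b-conj (conj-- b′-conj))))))
        where
        b-b′≢0 : b + - b′ ≢ 0#
        b-b′≢0 e₀ = b≢b′ (trans (solve 2 (λ b b′ → b := (b :+ :- b′) :+ b′) refl b b′)
                                 (trans (cong (_+ b′) e₀) (+-identityˡ b′)))
        z≡ : z ≡ (a′ + - a) * (b + - b′) ⁻¹
        z≡ = x*y≡z⇒y≡z*x⁻¹ (b + - b′) z (a′ + - a) b-b′≢0 (begin
          (b + - b′) * z                  ≡⟨ solve 5 (λ a b b′ z w → (b :+ :- b′) :* z := (a :+ b :* z) :+ :- (a :+ b′ :* z)) refl a b b′ z (a′ + b′ * z) ⟩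
          (a + b * z) + - (a + b′ * z)    ≡⟨ cong (λ w → w + - (a + b′ * z)) e ⟩
          (a′ + b′ * z) + - (a + b′ * z)  ≡⟨ solve 4 (λ a a′ b′ z → (a′ :+ b′ :* z) :+ :- (a :+ b′ :* z) := a′ :+ :- a) refl a a′ b′ z ⟩
          a′ + - a                        ∎)

    conjugable-square≤ : (R : List L) → Unique R → All ConjugatesToScalar R → length R ℕ.* length R ≤ length Ls
    conjugable-square≤ R R! R-conj = subst (_≤ length Ls) (length-cartesianProduct R R)
      (injection⇒length-≤ a+bz Conj² (cartesianProduct R R) Ls (Unique.cartesianProduct⁺ R! R!)
        (All.tabulate (λ p∈R² → let (a∈R , b∈R) = ∈-cartesianProduct⁻ R R p∈R² in
                                 All.lookup R-conj a∈R , All.lookup R-conj b∈R))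
        a+bz-injective (All.tabulate (λ {p} _ → Ls-complete (a+bz p))))

module ProjectivityToCollineation (F : Field) (K : Field.Carrier F → Set) (KS : IsSubfield F K)
                                  (_≟_ : DecidableEquality (Field.Carrier F))
                                  (T U : Geometry.Pair F K) where
  open Field F renaming (Carrier to L)
  open Endomorphisms F K KS _≟_
  open ≡-Reasoning

  private
    representative : ∀ {X} → LSet T X → L × L
    representative X∈L = a , b
      where open ρ-Representative (LSet⇒ρ-Representative X∈L)

    representative-∈B : ∀ {X} (X∈L : LSet T X) → BSet T (representative X∈L)
    representative-∈B X∈L = ρ-Representative.inB (LSet⇒ρ-Representative X∈L)

  distinct⇒independent-representatives : ∀ {X Y} (X∈L : LSet T X) (Y∈L : LSet T Y) →
    ¬ SamePoint X Y → Independent (representative X∈L) (representative Y∈L)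
  distinct⇒independent-representatives {X} {Y} X∈L Y∈L X≁Y det≡0 =
    X≁Y (proportional⇒samePoint (det₂≡0⇒proportional a b a′ b′ (proj₁ (ρ-Representative.inB rX)) det≡0))
    where
    rX : ρ-Representative T X
    rX = LSet⇒ρ-Representative X∈L
    rY : ρ-Representative T Y
    rY = LSet⇒ρ-Representative Y∈L
    a b a′ b′ : L
    a = ρ-Representative.a rX
    b = ρ-Representative.b rX
    a′ = ρ-Representative.a rY
    b′ = ρ-Representative.b rY
    proportional⇒samePoint : Σ L (λ l → (a′ ≡ l * a) × (b′ ≡ l * b)) → SamePoint X Y
    proportional⇒samePoint (l , a′≡la , b′≡lb) =
      samePoint-trans {X} {ρ a , ρ b} {Y} (samePoint-sym {ρ a , ρ b} {X} (ρ-Representative.same rX))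
      (samePoint-trans {ρ a , ρ b} {ρ (l * a) , ρ (l * b)} {Y} (samePoint-scale l≢0)
        (subst₂ (λ u v → SamePoint (ρ u , ρ v) Y) a′≡la b′≡lb (ρ-Representative.same rY)))
      where
      l≢0 : l ≢ 0#
      l≢0 l≡0 = proj₁ (ρ-Representative.inB rY) (trans a′≡la (u≡0⇒u*x≡0 _ l≡0) , trans b′≡lb (u≡0⇒u*x≡0 _ l≡0))

  representatives : ∀ {xs} → All (LSet T) xs → List (L × L)
  representatives = All.reduce representative

  representatives-length : ∀ {xs} (xs⊆L : All (LSet T) xs) → length (representatives xs⊆L) ≡ length xs
  representatives-length [] = refl
  representatives-length (_ ∷ xs⊆L) = cong suc (representatives-length xs⊆L)

  representatives-∈B : ∀ {xs} (xs⊆L : All (LSet T) xs) → All (BSet T) (representatives xs⊆L)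
  representatives-∈B [] = []
  representatives-∈B (X∈L ∷ xs⊆L) = representative-∈B X∈L ∷ representatives-∈B xs⊆L

  representatives-independent : ∀ {xs} (xs⊆L : All (LSet T) xs) → AllPairs (λ X Y → ¬ SamePoint X Y) xs →
                                AllPairs Independent (representatives xs⊆L)
  representatives-independent [] [] = []
  representatives-independent (X∈L ∷ xs⊆L) (X≁xs ∷ xs!) =
    head X∈L xs⊆L X≁xs ∷ representatives-independent xs⊆L xs!
    where
    head : ∀ {X ys} (X∈L : LSet T X) (ys⊆L : All (LSet T) ys) → All (λ Y → ¬ SamePoint X Y) ys →
           All (Independent (representative X∈L)) (representatives ys⊆L)
    head X∈L [] [] = []
    head X∈L (Y∈L ∷ ys⊆L) (X≁Y ∷ X≁ys) = distinct⇒independent-representatives X∈L Y∈L X≁Y ∷ head X∈L ys⊆L X≁ys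

  BSet-scale : ∀ {a b l} → l ≢ 0# → BSet T (a , b) → BSet T (l * a , l * b)
  BSet-scale {a} {b} {l} l≢0 (ab≢0 , ab≁T) =
    (λ (la≡0 , lb≡0) → ab≢0 (x*y≡0⇒y≡0 la≡0 l≢0 , x*y≡0⇒y≡0 lb≡0 l≢0)) ,
    nonDistant-resp-samePoint {ρ (l * a) , ρ (l * b)} {ρ a , ρ b}
      (samePoint-sym {ρ a , ρ b} {ρ (l * a) , ρ (l * b)} (samePoint-scale l≢0)) ab≁T

  opaque
    three-points⇒frame : ∀ {p₁ p₂ p₃} → BSet T p₁ → BSet T p₂ → BSet T p₃ →
                         Independent p₁ p₂ → Independent p₁ p₃ → Independent p₂ p₃ → Frame T
    three-points⇒frame {a₁ , b₁} {a₂ , b₂} {a₃ , b₃} p₁∈B p₂∈B p₃∈B p₁⊥p₂ p₁⊥p₃ p₂⊥p₃ = record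
      { a₁ = λ₁ * a₁ ; b₁ = λ₁ * b₁ ; a₂ = λ₂ * a₂ ; b₂ = λ₂ * b₂
      ; p₁∈B = BSet-scale λ₁≢0 p₁∈B
      ; p₂∈B = BSet-scale λ₂≢0 p₂∈B
      ; p₁+p₂∈B = subst₂ (λ u v → BSet T (u , v)) (sym cramer-a) (sym cramer-b) p₃∈B
      ; det≢0 = λ e → *-≢0 (*-≢0 λ₁≢0 λ₂≢0) p₁⊥p₂ (trans
          (solve 6 (λ l₁ l₂ a₁ b₁ a₂ b₂ → (l₁ :* l₂) :* (a₁ :* b₂ :+ :- (b₁ :* a₂)) := (l₁ :* a₁) :* (l₂ :* b₂) :+ :- ((l₁ :* b₁) :* (l₂ :* a₂))) refl λ₁ λ₂ a₁ b₁ a₂ b₂)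
          e)
      }
      where
      D D₃₂ λ₁ λ₂ : L
      D = det₂ a₁ b₁ a₂ b₂
      D₃₂ = det₂ a₃ b₃ a₂ b₂
      λ₁ = D₃₂ * D ⁻¹
      λ₂ = det₂ a₁ b₁ a₃ b₃ * D ⁻¹

      λ₁≢0 : λ₁ ≢ 0#
      λ₁≢0 = *-≢0 (λ D₃₂≡0 → p₂⊥p₃ (trans
        (solve 4 (λ a₂ b₂ a₃ b₃ → a₂ :* b₃ :+ :- (b₂ :* a₃) := :- (a₃ :* b₂ :+ :- (b₃ :* a₂))) refl a₂ b₂ a₃ b₃)
        (trans (cong -_ D₃₂≡0) -0#≈0#))) (⁻¹-≢0 p₁⊥p₂)

      λ₂≢0 : λ₂ ≢ 0#
      λ₂≢0 = *-≢0 p₁⊥p₃ (⁻¹-≢0 p₁⊥p₂)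

      D*D⁻¹≡1 : D * D ⁻¹ ≡ 1#
      D*D⁻¹≡1 = *-inverseʳ D p₁⊥p₂

      cramer-a : λ₁ * a₁ + λ₂ * a₂ ≡ a₃
      cramer-a = begin
        λ₁ * a₁ + λ₂ * a₂   ≡⟨ solve 7 (λ a₁ b₁ a₂ b₂ a₃ b₃ i → ((a₃ :* b₂ :+ :- (b₃ :* a₂)) :* i) :* a₁ :+ ((a₁ :* b₃ :+ :- (b₁ :* a₃)) :* i) :* a₂ := a₃ :* ((a₁ :* b₂ :+ :- (b₁ :* a₂)) :* i)) refl a₁ b₁ a₂ b₂ a₃ b₃ (D ⁻¹) ⟩
        a₃ * (D * D ⁻¹)     ≡⟨ cong (a₃ *_) D*D⁻¹≡1 ⟩
        a₃ * 1#             ≡⟨ *-identityʳ a₃ ⟩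
        a₃                  ∎

      cramer-b : λ₁ * b₁ + λ₂ * b₂ ≡ b₃
      cramer-b = begin
        λ₁ * b₁ + λ₂ * b₂   ≡⟨ solve 7 (λ a₁ b₁ a₂ b₂ a₃ b₃ i → ((a₃ :* b₂ :+ :- (b₃ :* a₂)) :* i) :* b₁ :+ ((a₁ :* b₃ :+ :- (b₁ :* a₃)) :* i) :* b₂ := b₃ :* ((a₁ :* b₂ :+ :- (b₁ :* a₂)) :* i)) refl a₁ b₁ a₂ b₂ a₃ b₃ (D ⁻¹) ⟩
        b₃ * (D * D ⁻¹)     ≡⟨ cong (b₃ *_) D*D⁻¹≡1 ⟩
        b₃ * 1#             ≡⟨ *-identityʳ b₃ ⟩
        b₃                  ∎

    frame-from-list : ∀ ps → 3 ℕ.≤ length ps → All (BSet T) ps → AllPairs Independent ps → Frame T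
    frame-from-list (_ ∷ _ ∷ _ ∷ _) _ (p₁∈B ∷ p₂∈B ∷ p₃∈B ∷ _) ((p₁⊥p₂ ∷ p₁⊥p₃ ∷ _) ∷ (p₂⊥p₃ ∷ _) ∷ _) =
      three-points⇒frame p₁∈B p₂∈B p₃∈B p₁⊥p₂ p₁⊥p₃ p₂⊥p₃
    frame-from-list [] () _ _
    frame-from-list (_ ∷ []) (s≤s ()) _ _
    frame-from-list (_ ∷ _ ∷ []) (s≤s (s≤s ())) _ _


  -- The counting hypothesis: a proper subfield, of some size n with n² ≤ |L|, cannot contain both
  -- the N - 1 ratios coming from the N points of L_T and the |K| + 1 elements of K ∪ {y}.
  projectivity⇒collineation :
    (Ls : List L) → (∀ x → x ∈ Ls) → (Ks : List L) → Unique Ks → All K Ks →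
    (xs : List Pair) → All (LSet T) xs → AllPairs (λ X Y → ¬ SamePoint X Y) xs → 3 ℕ.≤ length xs →
    (∀ n → length xs ℕ.≤ suc n → n ℕ.* n ℕ.≤ length Ls →
       ¬ (suc (length Ks) ℕ.* suc (length Ks) ℕ.≤ length Ls)) →
    CondII T U → CondI T U
  projectivity⇒collineation Ls Ls-complete Ks Ks! Ks⊆K xs xs⊆L xs! 3≤N too-many-points
                            (M , M-GL2E , L-T→L-U , L-U→L-T) =
    from-dichotomy (∀-or-counterexample ConjugatesToScalar?)
    where
    ps : List (L × L)
    ps = representatives xs⊆L
    ps-independent : AllPairs Independent ps
    ps-independent = representatives-independent xs⊆L xs!
    φ : Frame T
    φ = frame-from-list ps (subst (3 ℕ.≤_) (sym (representatives-length xs⊆L)) 3≤N)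
                       (representatives-∈B xs⊆L) ps-independent
    open ProjectivityImages.Images F K KS _≟_ T U M M-GL2E L-T→L-U
    open InFrame φ
    open FiniteConjugation F K KS _≟_ Ls Ls-complete γ-unit
    open Enumeration Ls Ls-complete using (∀-or-counterexample)
    open DecMembership _≟_ using (_∈?_)

    from-dichotomy : (∀ y → ConjugatesToScalar y) ⊎ Σ L (λ z → ¬ ConjugatesToScalar z) → CondI T U
    from-dichotomy (inj₁ all-conjugable) = semilinear-collineation (conjugable⇒semilinear all-conjugable)
      where
      semilinear-collineation : Σ (L → L) (λ η → IsGal η × (∀ y x → γ (y * x) ≡ η y * γ x)) → CondI T U
      semilinear-collineation (η , η-gal , γ-semilinear) =
        Collineation.collineation η-gal L-U→L-T (λ {a} {b} _ → γ-semilinear⇒SemilinearOn γ-semilinear a b)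
    from-dichotomy (inj₂ (z , z-not-conjugable)) =
      Collineation.collineation (SemilinearMatrices.id-isGal F K KS _≟_) L-U→L-T (conjugable-in-K⇒SemilinearOn conjugable⇒K)
      where
      R : List L
      R = ratios ps
      N≤1+|R| : length xs ℕ.≤ suc (length R)
      N≤1+|R| = subst (ℕ._≤ suc (length R)) (representatives-length xs⊆L) (length≤1+length-ratios ps-independent)
      |R|²≤|L| : length R ℕ.* length R ℕ.≤ length Ls
      |R|²≤|L| = conjugable-square≤ z z-not-conjugable R (ratios-unique ps-independent)
                   (ratios-conjugable (representatives-∈B xs⊆L))
      conjugable⇒K : ∀ y → ConjugatesToScalar y → K y
      conjugable⇒K y y-conj = by-membership (y ∈? Ks)
        where
        by-membership : Dec (y ∈ Ks) → K y
        by-membership (yes y∈Ks) = All.lookup Ks⊆K y∈Ks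
        by-membership (no y∉Ks) = ⊥-elim (too-many-points (length R) N≤1+|R| |R|²≤|L|
              (conjugable-square≤ z z-not-conjugable (y ∷ Ks)
                 (All.tabulate (λ k∈Ks y≡k → y∉Ks (subst (_∈ Ks) (sym y≡k) k∈Ks)) ∷ Ks!)
                 (y-conj ∷ All.map conj-K Ks⊆K)))

theorem18 : (q t : ℕ) → .{{_ : NonZero (q ∸ 1)}} → IsPrimePower q → 2 ≤ t →
    (F : Field) → (K : Field.Carrier F → Set) → IsSubfield F K →
    HasSize {Field.Carrier F} K q → HasSize {Field.Carrier F} (λ _ → ⊤) (q ^ t) →
    (T U : Geometry.Pair F K) → Geometry.Admissible F K T → Geometry.Admissible F K U →
    Geometry.Scattered F K q t T →
    (Geometry.CondI F K T U ⇔ Geometry.CondII F K T U)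
theorem18 (suc (suc p)) (suc t) _ (s≤s 1≤t) F K KS (Ks , Ks! , Ks⊆K , _ , |K|≡q) (Ls , Ls! , _ , Ls-covers , |L|≡q^t)
          T U _ _ (xs , xs⊆L , xs! , _ , |xs|≡θ) =
  mk⇔ (collineation⇒projectivity T U)
      (projectivity⇒collineation Ls Ls-complete Ks Ks! Ks⊆K xs xs⊆L xs!
        (subst (3 ≤_) (sym |xs|≡θ) (3≤θ t 1≤t)) too-many-points)
  where
  open PowerCounts p
  Ls-complete : ∀ x → x ∈ Ls
  Ls-complete x = Ls-covers x tt
  _≟_ : DecidableEquality (Field.Carrier F)
  _≟_ = Enumeration.≟-from-unique Ls Ls-complete Ls!
  open SemilinearMatrices F K KS _≟_ using (collineation⇒projectivity)
  open ProjectivityToCollineation F K KS _≟_ T U using (projectivity⇒collineation)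
  too-many-points : ∀ n → length xs ≤ suc n → n ℕ.* n ≤ length Ls → ¬ (suc (length Ks) ℕ.* suc (length Ks) ≤ length Ls)
  too-many-points n N≤1+n n²≤|L| [1+|K|]²≤|L|
    with θ≤1+n⇒n²≤q^t⇒t≡1 t n 1≤t (subst (_≤ suc n) |xs|≡θ N≤1+n) (subst (n ℕ.* n ≤_) |L|≡q^t n²≤|L|)
  ... | refl = [1+q]²≰q² (subst₂ (λ k l → suc k ℕ.* suc l ≤ _) |K|≡q |K|≡q (subst (_ ≤_) |L|≡q^t [1+|K|]²≤|L|))
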